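{- For integers $1\le k<n$, let $\mathcal{S}_n^{k\mapsto1}(321,4123)$ denote the set of permutations $\sigma\in\mathcal{S}_n(321,4123)$ with $\sigma(k)=1$. Then \[ \bigl|\mathcal{S}_n^{k\mapsto1}(321,4123)\bigr| = k\cdot \bigl|\mathcal{S}_{n-k}(321,4123)\bigr|. \] Moreover, the generating function $g(x,t) = \sum_{n\ge 1}\sum_{k=1}^n \bigl|\mathcal{S}_n^{k\mapsto1}(321,4123)\bigr|\, t^k x^n$ satisfies \[ g(x,t) = \frac{tx}{1-tx} + \frac{tx}{(1-tx)^2}\cdot \frac{x-x^2}{1-3x+x^2}. \]
   Context: Permutations of $[n]=\{1,\dots,n\}$ are written in one-line notation $\sigma=\sigma(1)\sigma(2)\cdots\sigma(n)$, and $\mathcal{S}_n$ is the set of all of them. A permutation $\sigma$ contains a pattern $\tau\in\mathcal{S}_k$ if it has a subsequence $\sigma(i_1),\dots,\sigma(i_k)$ ($i_1<\dots<i_k$) whose entries are in the same relative order as $\tau$; otherwise it avoids $\tau$. For a set $P$ of patterns, $\mathcal{S}_n(P)$ is the set of permutations in $\mathcal{S}_n$ avoiding every pattern in $P$. For $k=n$ the set $\mathcal{S}_n^{n\mapsto1}(321,4123)$ is defined in the same way. -}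

module Defs where

open import Data.Bool using (Bool; true; false; _∧_; _∨_; not; if_then_else_)
open import Data.Nat as ℕ using (ℕ; zero; suc; _∸_; _≤ᵇ_)
open import Data.Fin as Fin using (Fin; toℕ)
open import Data.Vec using (Vec; []; _∷_; lookup)
open import Data.List using (List; []; _∷_; map; concatMap; allFin; filter; length)
open import Data.Bool.ListAction using (all; any)
open import Data.Integer as ℤ using (ℤ; +_)
open import Relation.Nullary.Decidable using (⌊_⌋)
open import Relation.Unary using (Pred)

-- Words / permutations.
-- A candidate permutation of [n] is a vector σ : Vec (Fin n) n, where
-- position i (0-based) holds σ(i+1) - 1.  So value `zero` encodes 1.

allVecs : (n m : ℕ) → List (Vec (Fin n) m)
allVecs n zero    = [] ∷ []
allVecs n (suc m) = concatMap (λ a → map (a ∷_) (allVecs n m)) (allFin n)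

_==ᶠ_ : ∀ {n} → Fin n → Fin n → Bool
a ==ᶠ b = ⌊ a Fin.≟ b ⌋

_<ᶠ_ : ∀ {n} → Fin n → Fin n → Bool
a <ᶠ b = ⌊ a Fin.<? b ⌋

_==ᵇ_ : Bool → Bool → Bool
true  ==ᵇ b = b
false ==ᵇ b = not b

-- σ is injective, hence (length n over Fin n) a bijection of [n]
isPerm : ∀ {n} → Vec (Fin n) n → Bool
isPerm {n} σ = all (λ i → all (λ j → (i ==ᶠ j) ∨ not (lookup σ i ==ᶠ lookup σ j)) (allFin n)) (allFin n)

strictlyIncreasing : ∀ {n k} → Vec (Fin n) k → Bool
strictlyIncreasing {n} {k} ι =
  all (λ a → all (λ b → not (a <ᶠ b) ∨ (lookup ι a <ᶠ lookup ι b)) (allFin k)) (allFin k)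

contains : ∀ {n k} → Vec (Fin n) n → Vec (Fin k) k → Bool
contains {n} {k} σ τ = any (λ ι → strictlyIncreasing ι ∧
    all (λ a → all (λ b →
      (lookup σ (lookup ι a) <ᶠ lookup σ (lookup ι b)) ==ᵇ (lookup τ a <ᶠ lookup τ b))
      (allFin k)) (allFin k))
  (allVecs n k)

avoids : ∀ {n k} → Vec (Fin n) n → Vec (Fin k) k → Bool
avoids σ τ = not (contains σ τ)

-- the patterns 321 and 4123 (values shifted down by one)
p321 : Vec (Fin 3) 3
p321 = Fin.fromℕ< {2} (ℕ.s≤s (ℕ.s≤s (ℕ.s≤s ℕ.z≤n))) ∷ Fin.suc Fin.zero ∷ Fin.zero ∷ []

p4123 : Vec (Fin 4) 4
p4123 = Fin.suc (Fin.suc (Fin.suc Fin.zero)) ∷ Fin.zero ∷ Fin.suc Fin.zero ∷ Fin.suc (Fin.suc Fin.zero) ∷ []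

inClass : ∀ {n} → Vec (Fin n) n → Bool
inClass σ = isPerm σ ∧ avoids σ p321 ∧ avoids σ p4123

-- σ(k) = 1, for k a 1-based position
valueAtIsOne : ∀ {n} → Vec (Fin n) n → ℕ → Bool
valueAtIsOne {n} σ k = any (λ i → ⌊ suc (toℕ i) ℕ.≟ k ⌋ ∧ (toℕ (lookup σ i) ℕ.≡ᵇ 0)) (allFin n)

countS : ℕ → ℕ
countS n = length (filter (λ σ → inClass σ Data.Bool.≟ true) (allVecs n n))
  where import Data.Bool

countSk : ℕ → ℕ → ℕ
countSk n k = length (filter (λ σ → (inClass σ ∧ valueAtIsOne σ k) Data.Bool.≟ true) (allVecs n n))
  where import Data.Bool

-- Formal power series in x and t with integer coefficients:
-- F n k = coefficient of x^n t^k.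

Series : Set
Series = ℕ → ℕ → ℤ

sumTo : ℕ → (ℕ → ℤ) → ℤ
sumTo zero    f = f 0
sumTo (suc n) f = sumTo n f ℤ.+ f (suc n)

_⊕_ : Series → Series → Series
(F ⊕ G) n k = F n k ℤ.+ G n k

_⊖_ : Series → Series → Series
(F ⊖ G) n k = F n k ℤ.- G n k

_⊛_ : Series → Series → Series
(F ⊛ G) n k = sumTo n (λ i → sumTo k (λ j → F i j ℤ.* G (n ∸ i) (k ∸ j)))

const : ℤ → Series
const c zero zero = c
const c _    _    = + 0

oneS : Series
oneS = const (+ 1)

X : Series
X 1 0 = + 1
X _ _ = + 0

T : Series
T 0 1 = + 1
T _ _ = + 0

g : Series
g n k = if (1 ≤ᵇ n) ∧ (1 ≤ᵇ k) ∧ (k ≤ᵇ n) then + countSk n k else + 0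

module Submission where

-- Let σ avoid 321 and 4123 with σ(k) = 1. A 321 through the 1 forces the entries before
-- position k to increase, and if the last of them exceeded k + 1, two smaller entries after
-- the 1 would complete a 321 or a 4123 with it; so these entries are {2, …, k+1} ∖ {s} for a
-- single s. Every entry after the 1 is then s or exceeds k + 1, so standardising the suffix
-- gives τ ∈ S_{n-k}(321,4123) with s in the place of its minimum, and conversely every pair
-- (s, τ) reassembles; s is free in {2, …, k+1} unless n = k.
-- Summing over the position of 1 gives c(J+1) = Σ_{i<J} (i+1) c(J-i) + 1 for c = |S_·|, whence
-- c(J+3) + c(J+1) = 3 c(J+2). Multiplying g by (1 - tx)² takes second differences along the
-- diagonals k ↦ k c(n-k), which leaves only t and t² terms, and (1 - 3x + x²) then reduces
-- them to the numerator by the recurrence.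

open import Defs

module Permutations where

  import Data.Bool as Bool
  open import Data.Bool using (Bool; true; false; _∧_; _∨_; not)
  open import Data.Bool.ListAction using (all)
  open import Data.Bool.Properties using (T-≡; T-∧; T-∨)
  open import Data.Empty using (⊥; ⊥-elim)
  open import Data.Fin as Fin using (Fin; toℕ; fromℕ<)
  open import Data.Fin.Properties using (toℕ-injective; toℕ<n; toℕ-fromℕ<; pigeonhole; any?)
  open import Data.List
    using (List; []; _∷_; _++_; length; map; filter; concatMap; allFin; cartesianProduct; cartesianProductWith)
  open import Data.List.Properties using (length-map; length-++; length-tabulate)
  open import Data.List.Membership.Propositional using (_∈_; lose)
  open import Data.List.Membership.Propositional.Properties
    using (∈-map⁺; ∈-map⁻; ∈-allFin; ∈-filter⁺; ∈-filter⁻; ∈-cartesianProductWith⁺; ∈-cartesianProduct⁺; ∈-cartesianProduct⁻)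
  open import Data.List.Membership.Propositional.Properties.WithK using (unique∧set⇒bag)
  open import Data.List.Relation.Binary.BagAndSetEquality using (∼bag⇒↭)
  open import Data.List.Relation.Binary.Permutation.Propositional.Properties using (↭-length)
  open import Data.List.Relation.Unary.All as All using ()
  open import Data.List.Relation.Unary.All.Properties using (all⁺; all⁻; tabulate⁺)
  open import Data.List.Relation.Unary.AllPairs using ([]; _∷_)
  open import Data.List.Relation.Unary.Any using (here; satisfied)
  open import Data.List.Relation.Unary.Any.Properties using (any⁺; any⁻)
  open import Data.List.Relation.Unary.Unique.Propositional using (Unique)
  import Data.List.Relation.Unary.Unique.Propositional.Properties as Unique
  open import Data.Nat
    using (ℕ; zero; suc; _+_; _*_; _∸_; _≤_; _<_; z≤n; s≤s; z<s; s<s; _<?_; _≤?_; _≟_)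
  open import Data.Nat.Properties
  open import Data.Nat.Tactic.RingSolver using (solve-∀)
  open import Data.Product using (Σ; _×_; _,_; proj₁; proj₂)
  open import Data.Sum using (_⊎_; inj₁; inj₂)
  open import Data.Unit using (⊤; tt)
  open import Data.Vec using (Vec; []; _∷_; lookup)
  open import Data.Vec.Properties using (∷-injective)
  open import Function.Bundles using (_⇔_; mk⇔; Equivalence)
  open import Function.Definitions using (Injective)
  import Function.Related.Propositional
  open import Relation.Binary.Definitions using (tri<; tri≈; tri>)
  open import Relation.Binary.PropositionalEquality
  open import Relation.Nullary using (¬_; Dec; yes; no)
  open import Relation.Nullary.Decidable using (toWitness; fromWitness; isYes)

  open import Algebra.Properties.CommutativeSemigroup +-commutativeSemigroup using ()
    renaming (interchange to +-interchange)

  open Equivalence using (to; from)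

  length-≡-by-bijection : ∀ {A B : Set} {xs : List A} {ys : List B} → Unique xs → Unique ys →
    (φ : B → A) → Injective _≡_ _≡_ φ →
    (∀ {y} → y ∈ ys → φ y ∈ xs) → (∀ {x} → x ∈ xs → Σ B λ y → y ∈ ys × x ≡ φ y) →
    length xs ≡ length ys
  length-≡-by-bijection {xs = xs} {ys} uxs uys φ φ-inj into onto = begin
    length xs          ≡⟨ ↭-length (∼bag⇒↭ (unique∧set⇒bag uxs (Unique.map⁺ φ-inj uys) (mk⇔ image⁺ image⁻))) ⟩
    length (map φ ys)  ≡⟨ length-map φ ys ⟩
    length ys          ∎
    where
    open ≡-Reasoning
    image⁺ : ∀ {x} → x ∈ xs → x ∈ map φ ys
    image⁺ x∈ with onto x∈
    ... | y , y∈ , refl = ∈-map⁺ φ y∈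
    image⁻ : ∀ {x} → x ∈ map φ ys → x ∈ xs
    image⁻ x∈ with ∈-map⁻ φ x∈
    ... | y , y∈ , refl = into y∈

  length-cartesianProduct : ∀ {A B : Set} (xs : List A) (ys : List B) →
    length (cartesianProduct xs ys) ≡ length xs * length ys
  length-cartesianProduct []       ys = refl
  length-cartesianProduct (x ∷ xs) ys =
    trans (length-++ (map (x ,_) ys)) (cong₂ _+_ (length-map _ ys) (length-cartesianProduct xs ys))

  allVecs-suc : ∀ n m → allVecs n (suc m) ≡ cartesianProductWith _∷_ (allFin n) (allVecs n m)
  allVecs-suc n m = go (allFin n)
    where
    go : ∀ as → concatMap (λ a → map (a ∷_) (allVecs n m)) as ≡ cartesianProductWith _∷_ as (allVecs n m)
    go []       = refl
    go (a ∷ as) = cong (map (a ∷_) (allVecs n m) ++_) (go as)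

  allVecs-unique : ∀ n m → Unique (allVecs n m)
  allVecs-unique n zero    = All.[] ∷ []
  allVecs-unique n (suc m) rewrite allVecs-suc n m =
    Unique.cartesianProductWith⁺ _∷_ ∷-injective (Unique.allFin⁺ n) (allVecs-unique n m)

  ∈-allVecs : ∀ n m (v : Vec (Fin n) m) → v ∈ allVecs n m
  ∈-allVecs n zero    []      = here refl
  ∈-allVecs n (suc m) (a ∷ v) rewrite allVecs-suc n m =
    ∈-cartesianProductWith⁺ _∷_ (∈-allFin a) (∈-allVecs n m v)

  T-all-allFin : ∀ {n} (p : Fin n → Bool) → Bool.T (all p (allFin n)) ⇔ (∀ i → Bool.T (p i))
  T-all-allFin {n} p = mk⇔ (λ h i → All.lookup (all⁺ p (allFin n) h) (∈-allFin i)) (λ h → all⁻ p (tabulate⁺ h))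

  T-all²-allFin : ∀ {n} (r : Fin n → Fin n → Bool) →
    Bool.T (all (λ a → all (r a) (allFin n)) (allFin n)) ⇔ (∀ a b → Bool.T (r a b))
  T-all²-allFin r = mk⇔ (λ h a → to (T-all-allFin (r a)) (to (T-all-allFin _) h a))
                        (λ h → from (T-all-allFin _) (λ a → from (T-all-allFin (r a)) (h a)))

  T-not : ∀ {b} → Bool.T (not b) ⇔ (¬ Bool.T b)
  T-not {true}  = mk⇔ (λ ()) (λ h → h _)
  T-not {false} = mk⇔ (λ _ ()) (λ _ → _)

  T-not-∨ : ∀ {a b} → Bool.T (not a ∨ b) ⇔ (Bool.T a → Bool.T b)
  T-not-∨ {true}  = mk⇔ (λ h _ → h) (λ h → h _)
  T-not-∨ {false} = mk⇔ (λ _ ()) (λ _ → _)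

  T-==ᵇ : ∀ {a b} → Bool.T (a ==ᵇ b) ⇔ (Bool.T a ⇔ Bool.T b)
  T-==ᵇ {true}  {true}  = mk⇔ (λ _ → mk⇔ _ _) (λ _ → _)
  T-==ᵇ {true}  {false} = mk⇔ (λ ()) (λ h → to h _)
  T-==ᵇ {false} {true}  = mk⇔ (λ ()) (λ h → from h _)
  T-==ᵇ {false} {false} = mk⇔ (λ _ → mk⇔ (λ ()) (λ ())) (λ _ → _)

  -- Positions and values are 0-based, so the value 0 stands for 1; positions past the end read as 0.
  lookupℕ : ∀ {n m} → Vec (Fin n) m → ℕ → ℕ
  lookupℕ []       p       = 0
  lookupℕ (x ∷ xs) zero    = toℕ x
  lookupℕ (x ∷ xs) (suc p) = lookupℕ xs p

  lookupℕ-toℕ : ∀ {n m} (v : Vec (Fin n) m) (i : Fin m) → lookupℕ v (toℕ i) ≡ toℕ (lookup v i)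
  lookupℕ-toℕ (x ∷ v) Fin.zero    = refl
  lookupℕ-toℕ (x ∷ v) (Fin.suc i) = lookupℕ-toℕ v i

  lookupℕ-< : ∀ {n m} (v : Vec (Fin n) m) {p} → p < m → lookupℕ v p < n
  lookupℕ-< (x ∷ v) {zero}  _         = toℕ<n x
  lookupℕ-< (x ∷ v) {suc p} (s<s p<m) = lookupℕ-< v p<m

  lookupℕ-injective : ∀ {n m} (v w : Vec (Fin n) m) → (∀ {p} → p < m → lookupℕ v p ≡ lookupℕ w p) → v ≡ w
  lookupℕ-injective []      []      _ = refl
  lookupℕ-injective (x ∷ v) (y ∷ w) h =
    cong₂ _∷_ (toℕ-injective (h z<s)) (lookupℕ-injective v w (λ p<m → h (s<s p<m)))

  tabulateℕ : ∀ {n} m (f : ℕ → ℕ) → (∀ {p} → p < m → f p < n) → Vec (Fin n) m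
  tabulateℕ zero    f f< = []
  tabulateℕ (suc m) f f< = fromℕ< (f< z<s) ∷ tabulateℕ m (λ p → f (suc p)) (λ p<m → f< (s<s p<m))

  lookupℕ-tabulateℕ : ∀ {n} m (f : ℕ → ℕ) (f< : ∀ {p} → p < m → f p < n) {p} → p < m →
    lookupℕ (tabulateℕ m f f<) p ≡ f p
  lookupℕ-tabulateℕ (suc m) f f< {zero}  _         = toℕ-fromℕ< (f< z<s)
  lookupℕ-tabulateℕ (suc m) f f< {suc p} (s<s p<m) = lookupℕ-tabulateℕ m (λ p → f (suc p)) (λ q<m → f< (s<s q<m)) p<m

  lookupℕ-fromℕ< : ∀ {n m} (v : Vec (Fin n) m) {p} (p<m : p < m) → lookupℕ v p ≡ toℕ (lookup v (fromℕ< p<m))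
  lookupℕ-fromℕ< v {p} p<m = trans (cong (lookupℕ v) (sym (toℕ-fromℕ< p<m))) (lookupℕ-toℕ v (fromℕ< p<m))

  InjectiveOn : ℕ → (ℕ → ℕ) → Set
  InjectiveOn n f = ∀ {i j} → i < n → j < n → f i ≡ f j → i ≡ j

  MapsInto : ℕ → (ℕ → ℕ) → Set
  MapsInto n f = ∀ {i} → i < n → f i < n

  StrictlyIncreasingOn : ℕ → (ℕ → ℕ) → Set
  StrictlyIncreasingOn n f = ∀ {i j} → i < j → j < n → f i < f j

  record Occ321 (n : ℕ) (f : ℕ → ℕ) : Set where
    constructor occ321
    field
      {a b c} : ℕ
      a<b : a < b
      b<c : b < c
      c<n : c < n
      fc<fb : f c < f b
      fb<fa : f b < f a

  record Occ4123 (n : ℕ) (f : ℕ → ℕ) : Set where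
    constructor occ4123
    field
      {a b c d} : ℕ
      a<b : a < b
      b<c : b < c
      c<d : c < d
      d<n : d < n
      fb<fc : f b < f c
      fc<fd : f c < f d
      fd<fa : f d < f a

  record Avoiding (n : ℕ) (f : ℕ → ℕ) : Set where
    constructor avoiding
    field
      injective  : InjectiveOn n f
      avoids321  : ¬ Occ321 n f
      avoids4123 : ¬ Occ4123 n f

  T-isPerm : ∀ {n} (σ : Vec (Fin n) n) → Bool.T (isPerm σ) ⇔ InjectiveOn n (lookupℕ σ)
  T-isPerm {n} σ = mk⇔ sound complete
    where
    sound : Bool.T (isPerm σ) → InjectiveOn n (lookupℕ σ)
    sound h {i} {j} i<n j<n e
      with to (T-∨ {fromℕ< i<n ==ᶠ fromℕ< j<n}) (to (T-all²-allFin _) h (fromℕ< i<n) (fromℕ< j<n))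
    ... | inj₁ i≡j = trans (sym (toℕ-fromℕ< i<n)) (trans (cong toℕ (toWitness i≡j)) (toℕ-fromℕ< j<n))
    ... | inj₂ σi≢σj = ⊥-elim (to T-not σi≢σj (fromWitness (toℕ-injective
            (trans (sym (lookupℕ-fromℕ< σ i<n)) (trans e (lookupℕ-fromℕ< σ j<n))))))
    complete : InjectiveOn n (lookupℕ σ) → Bool.T (isPerm σ)
    complete inj = from (T-all²-allFin _) entry
      where
      entry : ∀ i j → Bool.T ((i ==ᶠ j) ∨ not (lookup σ i ==ᶠ lookup σ j))
      entry i j with i Fin.≟ j
      ... | yes i≡j = _
      ... | no i≢j  = from T-not (λ t → i≢j (toℕ-injective (inj (toℕ<n i) (toℕ<n j)
            (trans (lookupℕ-toℕ σ i) (trans (cong toℕ (toWitness t)) (sym (lookupℕ-toℕ σ j)))))))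

  increasing-by-steps : ∀ {n} (f : ℕ → ℕ) → (∀ {i} → suc i < n → f i < f (suc i)) → StrictlyIncreasingOn n f
  increasing-by-steps f step {i} {suc j} i<1+j 1+j<n with m<1+n⇒m<n∨m≡n i<1+j
  ... | inj₁ i<j  = <-trans (increasing-by-steps f step i<j (<-trans (n<1+n j) 1+j<n)) (step 1+j<n)
  ... | inj₂ refl = step 1+j<n

  increasing⇒<-⇔ : ∀ {n} {f : ℕ → ℕ} → StrictlyIncreasingOn n f → ∀ {i j} → i < n → j < n → (f i < f j ⇔ i < j)
  increasing⇒<-⇔ {f = f} inc {i} {j} i<n j<n = mk⇔ reflect (λ i<j → inc i<j j<n)
    where
    reflect : f i < f j → i < j
    reflect fi<fj with <-cmp i j
    ... | tri< i<j _ _ = i<j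
    ... | tri≈ _ refl _ = ⊥-elim (<-irrefl refl fi<fj)
    ... | tri> _ _ j<i = ⊥-elim (<-asym fi<fj (inc j<i i<n))

  T-<ᶠ : ∀ {n} {u v : Fin n} → Bool.T (u <ᶠ v) ⇔ toℕ u < toℕ v
  T-<ᶠ {u = u} {v} = mk⇔ (toWitness {a? = u Fin.<? v}) fromWitness

  T-==ᵇ-<ᶠ : ∀ {n k} {u v : Fin n} {x y : Fin k} →
    Bool.T ((u <ᶠ v) ==ᵇ (x <ᶠ y)) ⇔ (toℕ u < toℕ v ⇔ toℕ x < toℕ y)
  T-==ᵇ-<ᶠ {u = u} {v} {x} {y} = mk⇔
    (λ h → let same = to (T-==ᵇ {u <ᶠ v}) h in
      mk⇔ (λ lt → to T-<ᶠ (to same (from T-<ᶠ lt))) (λ lt → to T-<ᶠ (from same (from T-<ᶠ lt))))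
    (λ same → from (T-==ᵇ {u <ᶠ v}) (mk⇔ (λ lt → from T-<ᶠ (to same (to T-<ᶠ lt))) (λ lt → from T-<ᶠ (from same (to T-<ᶠ lt)))))

  record Embeds {n k} (σ : Vec (Fin n) n) (τ : Vec (Fin k) k) : Set where
    constructor embeds
    field
      positions  : Vec (Fin n) k
      increasing : StrictlyIncreasingOn k (lookupℕ positions)
      sameOrder  : ∀ {x y} → x < k → y < k →
        (lookupℕ σ (lookupℕ positions x) < lookupℕ σ (lookupℕ positions y) ⇔ lookupℕ τ x < lookupℕ τ y)

  lookupℕ-lookup² : ∀ {n m k} (σ : Vec (Fin n) m) (ι : Vec (Fin m) k) a →
    lookupℕ σ (lookupℕ ι (toℕ a)) ≡ toℕ (lookup σ (lookup ι a))
  lookupℕ-lookup² σ ι a = trans (cong (lookupℕ σ) (lookupℕ-toℕ ι a)) (lookupℕ-toℕ σ (lookup ι a))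

  contains⇒Embeds : ∀ {n k} (σ : Vec (Fin n) n) (τ : Vec (Fin k) k) → Bool.T (contains σ τ) → Embeds σ τ
  contains⇒Embeds {n} {k} σ τ h with satisfied (any⁻ _ (allVecs n k) h)
  ... | ι , hι with to T-∧ hι
  ... | incι , ordι = embeds ι increasing sameOrder
    where
    increasing : StrictlyIncreasingOn k (lookupℕ ι)
    increasing {i} {j} i<j j<k = begin-strict
      lookupℕ ι i                    ≡⟨ lookupℕ-fromℕ< ι i<k ⟩
      toℕ (lookup ι (fromℕ< i<k))    <⟨ to T-<ᶠ (to (T-not-∨ {fromℕ< i<k <ᶠ fromℕ< j<k})
                                          (to (T-all²-allFin _) incι (fromℕ< i<k) (fromℕ< j<k)) (from T-<ᶠ i<j′)) ⟩
      toℕ (lookup ι (fromℕ< j<k))    ≡⟨ sym (lookupℕ-fromℕ< ι j<k) ⟩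
      lookupℕ ι j                    ∎
      where
      open ≤-Reasoning
      i<k = <-trans i<j j<k
      i<j′ : toℕ (fromℕ< i<k) < toℕ (fromℕ< j<k)
      i<j′ = subst₂ _<_ (sym (toℕ-fromℕ< i<k)) (sym (toℕ-fromℕ< j<k)) i<j
    sameOrder : ∀ {x y} → x < k → y < k →
      (lookupℕ σ (lookupℕ ι x) < lookupℕ σ (lookupℕ ι y) ⇔ lookupℕ τ x < lookupℕ τ y)
    sameOrder {x} {y} x<k y<k = begin
      lookupℕ σ (lookupℕ ι x) < lookupℕ σ (lookupℕ ι y)
        ≡⟨ cong₂ _<_ (at-fromℕ< x<k) (at-fromℕ< y<k) ⟩
      toℕ (lookup σ (lookup ι (fromℕ< x<k))) < toℕ (lookup σ (lookup ι (fromℕ< y<k)))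
        ∼⟨ to T-==ᵇ-<ᶠ (to (T-all²-allFin _) ordι (fromℕ< x<k) (fromℕ< y<k)) ⟩
      toℕ (lookup τ (fromℕ< x<k)) < toℕ (lookup τ (fromℕ< y<k))
        ≡⟨ sym (cong₂ _<_ (lookupℕ-fromℕ< τ x<k) (lookupℕ-fromℕ< τ y<k)) ⟩
      lookupℕ τ x < lookupℕ τ y ∎
      where
      open Function.Related.Propositional.EquationalReasoning
      at-fromℕ< : ∀ {p} (p<k : p < k) → lookupℕ σ (lookupℕ ι p) ≡ toℕ (lookup σ (lookup ι (fromℕ< p<k)))
      at-fromℕ< p<k = trans (cong (λ q → lookupℕ σ (lookupℕ ι q)) (sym (toℕ-fromℕ< p<k))) (lookupℕ-lookup² σ ι (fromℕ< p<k))

  Embeds⇒contains : ∀ {n k} (σ : Vec (Fin n) n) (τ : Vec (Fin k) k) → Embeds σ τ → Bool.T (contains σ τ)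
  Embeds⇒contains {n} {k} σ τ (embeds ι increasing sameOrder) =
    any⁺ _ (lose (∈-allVecs n k ι) (from (T-∧ {strictlyIncreasing ι}) (from (T-all²-allFin _) incι , from (T-all²-allFin _) ordι)))
    where
    incι : ∀ a b → Bool.T (not (a <ᶠ b) ∨ (lookup ι a <ᶠ lookup ι b))
    incι a b = from (T-not-∨ {a <ᶠ b}) (λ a<b → from T-<ᶠ (subst₂ _<_ (lookupℕ-toℕ ι a) (lookupℕ-toℕ ι b)
                 (increasing (to T-<ᶠ a<b) (toℕ<n b))))
    ordι : ∀ a b → Bool.T ((lookup σ (lookup ι a) <ᶠ lookup σ (lookup ι b)) ==ᵇ (lookup τ a <ᶠ lookup τ b))
    ordι a b = from T-==ᵇ-<ᶠ (begin
      toℕ (lookup σ (lookup ι a)) < toℕ (lookup σ (lookup ι b))     ≡⟨ sym (cong₂ _<_ (lookupℕ-lookup² σ ι a) (lookupℕ-lookup² σ ι b)) ⟩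
      lookupℕ σ (lookupℕ ι (toℕ a)) < lookupℕ σ (lookupℕ ι (toℕ b)) ∼⟨ sameOrder (toℕ<n a) (toℕ<n b) ⟩
      lookupℕ τ (toℕ a) < lookupℕ τ (toℕ b)                         ≡⟨ cong₂ _<_ (lookupℕ-toℕ τ a) (lookupℕ-toℕ τ b) ⟩
      toℕ (lookup τ a) < toℕ (lookup τ b)                            ∎)
      where open Function.Related.Propositional.EquationalReasoning

  nth : List ℕ → ℕ → ℕ
  nth []       _       = 0
  nth (x ∷ xs) zero    = x
  nth (x ∷ xs) (suc i) = nth xs i

  embeds-via : ∀ {n k} (σ : Vec (Fin n) n) (τ : Vec (Fin k) k) (pos h : ℕ → ℕ) →
    (∀ {p} → p < k → pos p < n) → StrictlyIncreasingOn k pos → StrictlyIncreasingOn k h →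
    (∀ {x} → x < k → lookupℕ σ (pos x) ≡ h (lookupℕ τ x)) → Embeds σ τ
  embeds-via {n} {k} σ τ pos h pos< pos-inc h-inc σ∘pos≡h∘τ = embeds ι ι-inc sameOrder
    where
    ι = tabulateℕ k pos pos<
    ι≡pos : ∀ {p} → p < k → lookupℕ ι p ≡ pos p
    ι≡pos = lookupℕ-tabulateℕ k pos pos<
    ι-inc : StrictlyIncreasingOn k (lookupℕ ι)
    ι-inc i<j j<k = subst₂ _<_ (sym (ι≡pos (<-trans i<j j<k))) (sym (ι≡pos j<k)) (pos-inc i<j j<k)
    sameOrder : ∀ {x y} → x < k → y < k → (lookupℕ σ (lookupℕ ι x) < lookupℕ σ (lookupℕ ι y) ⇔ lookupℕ τ x < lookupℕ τ y)
    sameOrder x<k y<k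
      rewrite ι≡pos x<k | ι≡pos y<k | σ∘pos≡h∘τ x<k | σ∘pos≡h∘τ y<k = increasing⇒<-⇔ h-inc (lookupℕ-< τ x<k) (lookupℕ-< τ y<k)

  increasing-below-last : ∀ {k n} {f : ℕ → ℕ} → StrictlyIncreasingOn (suc k) f → f k < n → ∀ {p} → p < suc k → f p < n
  increasing-below-last inc fk<n {p} p<1+k with m<1+n⇒m<n∨m≡n p<1+k
  ... | inj₁ p<k  = <-trans (inc p<k (n<1+n _)) fk<n
  ... | inj₂ refl = fk<n

  T-contains321 : ∀ {n} (σ : Vec (Fin n) n) → Bool.T (contains σ p321) ⇔ Occ321 n (lookupℕ σ)
  T-contains321 {n} σ = mk⇔ (λ h → occurrence (contains⇒Embeds σ p321 h)) (λ o → Embeds⇒contains σ p321 (embedding o))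
    where
    occurrence : Embeds σ p321 → Occ321 n (lookupℕ σ)
    occurrence (embeds ι inc same) = occ321 (inc z<s (s<s z<s)) (inc (s<s z<s) (s<s (s<s z<s))) (lookupℕ-< ι (s<s (s<s z<s)))
      (from (same (s<s (s<s z<s)) (s<s z<s)) z<s) (from (same (s<s z<s) z<s) (s<s z<s))
    embedding : Occ321 n (lookupℕ σ) → Embeds σ p321
    embedding (occ321 {a} {b} {c} a<b b<c c<n fc<fb fb<fa) =
      embeds-via σ p321 positions values (increasing-below-last positions-inc c<n) positions-inc values-inc σ≡values
      where
      f = lookupℕ σ
      positions = nth (a ∷ b ∷ c ∷ [])
      values = nth (f c ∷ f b ∷ f a ∷ [])
      positions-inc : StrictlyIncreasingOn 3 positions
      positions-inc = increasing-by-steps _ λ { {0} _ → a<b ; {1} _ → b<c ; {2} (s<s (s<s (s<s ()))) }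
      values-inc : StrictlyIncreasingOn 3 values
      values-inc = increasing-by-steps _ λ { {0} _ → fc<fb ; {1} _ → fb<fa ; {2} (s<s (s<s (s<s ()))) }
      σ≡values : ∀ {x} → x < 3 → f (positions x) ≡ values (lookupℕ p321 x)
      σ≡values {0} _ = refl
      σ≡values {1} _ = refl
      σ≡values {2} _ = refl
      σ≡values {suc (suc (suc _))} (s<s (s<s (s<s ())))

  T-contains4123 : ∀ {n} (σ : Vec (Fin n) n) → Bool.T (contains σ p4123) ⇔ Occ4123 n (lookupℕ σ)
  T-contains4123 {n} σ = mk⇔ (λ h → occurrence (contains⇒Embeds σ p4123 h)) (λ o → Embeds⇒contains σ p4123 (embedding o))
    where
    occurrence : Embeds σ p4123 → Occ4123 n (lookupℕ σ)
    occurrence (embeds ι inc same) =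
      occ4123 (inc z<s (s<s z<s)) (inc (s<s z<s) (s<s (s<s z<s))) (inc (s<s (s<s z<s)) (s<s (s<s (s<s z<s))))
        (lookupℕ-< ι (s<s (s<s (s<s z<s))))
        (from (same (s<s z<s) (s<s (s<s z<s))) z<s) (from (same (s<s (s<s z<s)) (s<s (s<s (s<s z<s)))) (s<s z<s))
        (from (same (s<s (s<s (s<s z<s))) z<s) (s<s (s<s z<s)))
    embedding : Occ4123 n (lookupℕ σ) → Embeds σ p4123
    embedding (occ4123 {a} {b} {c} {d} a<b b<c c<d d<n fb<fc fc<fd fd<fa) =
      embeds-via σ p4123 positions values (increasing-below-last positions-inc d<n) positions-inc values-inc σ≡values
      where
      f = lookupℕ σ
      positions = nth (a ∷ b ∷ c ∷ d ∷ [])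
      values = nth (f b ∷ f c ∷ f d ∷ f a ∷ [])
      positions-inc : StrictlyIncreasingOn 4 positions
      positions-inc = increasing-by-steps _ λ { {0} _ → a<b ; {1} _ → b<c ; {2} _ → c<d ; {3} (s<s (s<s (s<s (s<s ())))) }
      values-inc : StrictlyIncreasingOn 4 values
      values-inc = increasing-by-steps _ λ { {0} _ → fb<fc ; {1} _ → fc<fd ; {2} _ → fd<fa ; {3} (s<s (s<s (s<s (s<s ())))) }
      σ≡values : ∀ {x} → x < 4 → f (positions x) ≡ values (lookupℕ p4123 x)
      σ≡values {0} _ = refl
      σ≡values {1} _ = refl
      σ≡values {2} _ = refl
      σ≡values {3} _ = refl
      σ≡values {suc (suc (suc (suc _)))} (s<s (s<s (s<s (s<s ()))))

  inClass⇔Avoiding : ∀ {n} (σ : Vec (Fin n) n) → inClass σ ≡ true ⇔ Avoiding n (lookupℕ σ)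
  inClass⇔Avoiding {n} σ = mk⇔ sound complete
    where
    sound : inClass σ ≡ true → Avoiding n (lookupℕ σ)
    sound h with to T-∧ (from T-≡ h)
    ... | perm , avoid with to (T-∧ {not (contains σ p321)}) avoid
    ... | av321 , av4123 = avoiding (to (T-isPerm σ) perm)
      (λ o → to T-not av321 (from (T-contains321 σ) o)) (λ o → to T-not av4123 (from (T-contains4123 σ) o))
    complete : Avoiding n (lookupℕ σ) → inClass σ ≡ true
    complete (avoiding inj av321 av4123) = to T-≡ (from T-∧ (from (T-isPerm σ) inj ,
      from T-∧ (from T-not (λ c → av321 (to (T-contains321 σ) c)) , from T-not (λ c → av4123 (to (T-contains4123 σ) c)))))

  T-valueAtIsOne : ∀ {n} (σ : Vec (Fin n) n) p → valueAtIsOne σ (suc p) ≡ true ⇔ (p < n × lookupℕ σ p ≡ 0)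
  T-valueAtIsOne {n} σ p = mk⇔ sound complete
    where
    sound : valueAtIsOne σ (suc p) ≡ true → p < n × lookupℕ σ p ≡ 0
    sound h with satisfied (any⁻ _ (allFin n) (from T-≡ h))
    ... | i , hi with to (T-∧ {isYes (suc (toℕ i) ≟ suc p)}) hi
    ... | i≡p , σi≡0 with suc-injective (toWitness i≡p)
    ... | refl = toℕ<n i , trans (lookupℕ-toℕ σ i) (≡ᵇ⇒≡ _ 0 σi≡0)
    complete : p < n × lookupℕ σ p ≡ 0 → valueAtIsOne σ (suc p) ≡ true
    complete (p<n , σp≡0) = to T-≡ (any⁺ _ (lose (∈-allFin (fromℕ< p<n))
      (from T-∧ (fromWitness (cong suc (toℕ-fromℕ< p<n)) , ≡⇒≡ᵇ _ 0 (trans (sym (lookupℕ-fromℕ< σ p<n)) σp≡0)))))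

  Avoiding-cong : ∀ {n} {f g : ℕ → ℕ} → (∀ {p} → p < n → f p ≡ g p) → Avoiding n f → Avoiding n g
  Avoiding-cong {n} {f} {g} f≗g (avoiding inj av321 av4123) = avoiding inj′ (λ o → av321 (occ321′ o)) (λ o → av4123 (occ4123′ o))
    where
    inj′ : InjectiveOn n g
    inj′ i<n j<n e = inj i<n j<n (trans (f≗g i<n) (trans e (sym (f≗g j<n))))
    occ321′ : Occ321 n g → Occ321 n f
    occ321′ (occ321 a<b b<c c<n v₁ v₂) = occ321 a<b b<c c<n
      (subst₂ _<_ (sym (f≗g c<n)) (sym (f≗g b<n)) v₁) (subst₂ _<_ (sym (f≗g b<n)) (sym (f≗g a<n)) v₂)
      where
      b<n = <-trans b<c c<n
      a<n = <-trans a<b b<n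
    occ4123′ : Occ4123 n g → Occ4123 n f
    occ4123′ (occ4123 a<b b<c c<d d<n w₁ w₂ w₃) = occ4123 a<b b<c c<d d<n
      (subst₂ _<_ (sym (f≗g b<n)) (sym (f≗g c<n)) w₁) (subst₂ _<_ (sym (f≗g c<n)) (sym (f≗g d<n)) w₂)
      (subst₂ _<_ (sym (f≗g d<n)) (sym (f≗g a<n)) w₃)
      where
      c<n = <-trans c<d d<n
      b<n = <-trans b<c c<n
      a<n = <-trans a<b b<n

  -- Assembling a permutation around its 1

  data Region (L : ℕ) : ℕ → Set where
    before : ∀ {p} → p < L → Region L p
    atL    : Region L L
    after  : ∀ q → Region L (suc L + q)

  region : ∀ L p → Region L p
  region L p with p <? L
  ... | yes p<L = before p<L
  ... | no p≮L with p ≟ L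
  ... | yes refl = atL
  ... | no p≢L = subst (Region L) (m+[n∸m]≡n (≤∧≢⇒< (≮⇒≥ p≮L) (≢-sym p≢L))) (after (p ∸ suc L))

  prefixValue : ℕ → ℕ → ℕ
  prefixValue s p with suc p <? s
  ... | yes _ = suc p
  ... | no _  = suc (suc p)

  prefixValue-below : ∀ {s p} → suc p < s → prefixValue s p ≡ suc p
  prefixValue-below {s} {p} 1+p<s with suc p <? s
  ... | yes _     = refl
  ... | no 1+p≮s  = ⊥-elim (1+p≮s 1+p<s)

  prefixValue-above : ∀ {s p} → ¬ suc p < s → prefixValue s p ≡ suc (suc p)
  prefixValue-above {s} {p} 1+p≮s with suc p <? s
  ... | yes 1+p<s = ⊥-elim (1+p≮s 1+p<s)
  ... | no _      = refl

  prefixValue-≥ : ∀ s p → suc p ≤ prefixValue s p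
  prefixValue-≥ s p with suc p <? s
  ... | yes _ = ≤-refl
  ... | no _  = n≤1+n _

  prefixValue-≤ : ∀ s p → prefixValue s p ≤ suc (suc p)
  prefixValue-≤ s p with suc p <? s
  ... | yes _ = n≤1+n _
  ... | no _  = ≤-refl

  prefixValue-increasing : ∀ s {p p′} → p < p′ → prefixValue s p < prefixValue s p′
  prefixValue-increasing s {p} {p′} p<p′ with suc p′ <? s
  ... | yes 1+p′<s = subst (_< suc p′) (sym (prefixValue-below (<-trans (s<s p<p′) 1+p′<s))) (s<s p<p′)
  ... | no _       = ≤-<-trans (prefixValue-≤ s p) (s<s (s<s p<p′))

  prefixValue-≢ : ∀ {s} p → prefixValue s p ≢ s
  prefixValue-≢ {s} p with suc p <? s
  ... | yes 1+p<s = <⇒≢ 1+p<s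
  ... | no 1+p≮s  = λ e → 1+p≮s (subst (suc p <_) e ≤-refl)

  prefixValue-covers : ∀ {L s} v → 1 ≤ s → s ≤ suc L → 1 ≤ v → v ≤ suc L → v ≢ s →
    Σ ℕ λ p → p < L × prefixValue s p ≡ v
  prefixValue-covers {L} {s} (suc v) 1≤s s≤1+L _ v≤1+L v≢s with <-cmp (suc v) s
  ... | tri< v<s _ _ = v , ≤-pred (<-≤-trans v<s s≤1+L) , prefixValue-below v<s
  ... | tri≈ _ v≡s _ = ⊥-elim (v≢s v≡s)
  ... | tri> _ _ s<v with v | s<v
  ...   | zero  | s≤s s≤0   = ⊥-elim (<⇒≱ 1≤s s≤0)
  ...   | suc w | s≤s s≤1+w = w , ≤-pred v≤1+L , prefixValue-above (λ 1+w<s → <-irrefl refl (<-≤-trans 1+w<s s≤1+w))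

  suffixValue : ℕ → ℕ → ℕ → ℕ
  suffixValue L s zero    = s
  suffixValue L s (suc v) = suc L + suc v

  suffixValue-increasing : ∀ {L s} → s ≤ suc L → ∀ {v v′} → v < v′ → suffixValue L s v < suffixValue L s v′
  suffixValue-increasing {L} s≤1+L {zero}  {suc v′} _         = ≤-<-trans s≤1+L (m<m+n (suc L) z<s)
  suffixValue-increasing {L} s≤1+L {suc v} {suc v′} (s<s v<v′) = +-monoʳ-< (suc L) (s<s v<v′)

  suffixValue-<-reflects : ∀ {L s} → s ≤ suc L → ∀ {v v′} → suffixValue L s v < suffixValue L s v′ → v < v′
  suffixValue-<-reflects s≤1+L {v} {v′} lt with <-cmp v v′
  ... | tri< v<v′ _ _ = v<v′
  ... | tri≈ _ refl _ = ⊥-elim (<-irrefl refl lt)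
  ... | tri> _ _ v′<v = ⊥-elim (<-asym lt (suffixValue-increasing s≤1+L v′<v))

  suffixValue-injective : ∀ {L s} → s ≤ suc L → ∀ {v v′} → suffixValue L s v ≡ suffixValue L s v′ → v ≡ v′
  suffixValue-injective s≤1+L {v} {v′} e with <-cmp v v′
  ... | tri< v<v′ _ _ = ⊥-elim (<⇒≢ (suffixValue-increasing s≤1+L v<v′) e)
  ... | tri≈ _ v≡v′ _ = v≡v′
  ... | tri> _ _ v′<v = ⊥-elim (<⇒≢ (suffixValue-increasing s≤1+L v′<v) (sym e))

  suffixValue-small : ∀ {L s} v → suffixValue L s v ≤ suc L → v ≡ 0
  suffixValue-small     zero    _ = refl
  suffixValue-small {L} (suc v) h = ⊥-elim (<⇒≱ (m<m+n (suc L) z<s) h)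

  suffixValue-positive : ∀ {L s} → 1 ≤ s → ∀ v → 1 ≤ suffixValue L s v
  suffixValue-positive 1≤s zero    = 1≤s
  suffixValue-positive 1≤s (suc v) = s≤s z≤n

  suffixValue-suc : ∀ {L s d} → 0 < d → suffixValue L s d ≡ suc L + d
  suffixValue-suc {d = suc d} _ = refl

  -- The first L entries enumerate {1, …, L+1} ∖ {s} increasingly, the entry at L is 0, and the
  -- rest is t with its value 0 replaced by s and every other value v moved to L + 1 + v.
  assemble : ℕ → ℕ → (ℕ → ℕ) → ℕ → ℕ
  assemble L s t p with p <? L
  ... | yes _ = prefixValue s p
  ... | no _ with p ≟ L
  ...   | yes _ = 0
  ...   | no _  = suffixValue L s (t (p ∸ suc L))

  assemble-before : ∀ L s t {p} → p < L → assemble L s t p ≡ prefixValue s p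
  assemble-before L s t {p} p<L with p <? L
  ... | yes _   = refl
  ... | no p≮L  = ⊥-elim (p≮L p<L)

  assemble-at : ∀ L s t → assemble L s t L ≡ 0
  assemble-at L s t with L <? L
  ... | yes L<L = ⊥-elim (<-irrefl refl L<L)
  ... | no _ with L ≟ L
  ...   | yes _   = refl
  ...   | no L≢L  = ⊥-elim (L≢L refl)

  assemble-after : ∀ L s t q → assemble L s t (suc L + q) ≡ suffixValue L s (t q)
  assemble-after L s t q with suc L + q <? L
  ... | yes lt = ⊥-elim (<-asym lt L<1+L+q)
    where L<1+L+q = ≤-<-trans (m≤m+n L q) (n<1+n (L + q))
  ... | no _ with suc L + q ≟ L
  ...   | yes e = ⊥-elim (<⇒≢ (≤-<-trans (m≤m+n L q) (n<1+n (L + q))) (sym e))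
  ...   | no _  = cong (λ r → suffixValue L s (t r)) (m+n∸m≡n (suc L) q)

  assemble-cong : ∀ L m s {t t′ : ℕ → ℕ} → (∀ {q} → q < m → t q ≡ t′ q) →
    ∀ {p} → p < suc L + m → assemble L s t p ≡ assemble L s t′ p
  assemble-cong L m s {t} {t′} t≗t′ {p} p<n with region L p
  ... | before p<L = trans (assemble-before L s t p<L) (sym (assemble-before L s t′ p<L))
  ... | atL        = trans (assemble-at L s t) (sym (assemble-at L s t′))
  ... | after q    = trans (assemble-after L s t q)
                       (trans (cong (suffixValue L s) (t≗t′ (+-cancelˡ-< (suc L) q m p<n))) (sym (assemble-after L s t′ q)))

  module Assembled (L m s : ℕ) (t : ℕ → ℕ) (1≤s : 1 ≤ s) (s≤1+L : s ≤ suc L) where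

    private
      n : ℕ
      n = suc L + m
      f : ℕ → ℕ
      f = assemble L s t

      f-before : ∀ {p} → p < L → f p ≡ prefixValue s p
      f-before = assemble-before L s t
      f-at : f L ≡ 0
      f-at = assemble-at L s t
      f-after : ∀ q → f (suc L + q) ≡ suffixValue L s (t q)
      f-after = assemble-after L s t

      before-positive : ∀ {p} → p < L → 0 < f p
      before-positive {p} p<L = subst (0 <_) (sym (f-before p<L)) (<-≤-trans z<s (prefixValue-≥ s p))

      after-positive : ∀ q → 0 < f (suc L + q)
      after-positive q = subst (0 <_) (sym (f-after q)) (suffixValue-positive 1≤s (t q))

      before-≤ : ∀ {p} → p < L → f p ≤ suc L
      before-≤ {p} p<L = subst (_≤ suc L) (sym (f-before p<L)) (≤-trans (prefixValue-≤ s p) (s≤s p<L))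

      after-small : ∀ q → f (suc L + q) ≤ suc L → f (suc L + q) ≡ s
      after-small q h rewrite f-after q with suffixValue-small {L} {s} (t q) h
      ... | t≡0 rewrite t≡0 = refl

      before≢after : ∀ {p} q → p < L → f p ≢ f (suc L + q)
      before≢after {p} q p<L e = prefixValue-≢ {s} p (trans (sym (f-before p<L)) (trans e (after-small q (subst (_≤ suc L) e (before-≤ p<L)))))

      before-increasing : ∀ {p p′} → p < p′ → p′ < L → f p < f p′
      before-increasing p<p′ p′<L =
        subst₂ _<_ (sym (f-before (<-trans p<p′ p′<L))) (sym (f-before p′<L)) (prefixValue-increasing s p<p′)

    mapsInto : MapsInto m t → (1 ≤ m ⊎ s ≡ suc L) → MapsInto n f
    mapsInto t-maps m≥1∨s≡1+L {p} p<n with region L p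
    ... | atL = subst (_< n) (sym f-at) z<s
    ... | after q = subst (_< n) (sym (f-after q)) (suffix-< (t q) (t-maps (+-cancelˡ-< (suc L) q m p<n)))
      where
      suffix-< : ∀ v → v < m → suffixValue L s v < n
      suffix-< zero    0<m   = ≤-<-trans s≤1+L (m<m+n (suc L) 0<m)
      suffix-< (suc v) 1+v<m = +-monoʳ-< (suc L) 1+v<m
    mapsInto t-maps (inj₁ 1≤m) {p} p<n | before p<L = ≤-<-trans (before-≤ p<L) (m<m+n (suc L) 1≤m)
    mapsInto t-maps (inj₂ refl) {p} p<n | before p<L =
      subst (_< n) (sym (trans (f-before p<L) (prefixValue-below (s<s p<L)))) (≤-trans (s≤s p<L) (m≤m+n (suc L) m))

    injective : InjectiveOn m t → InjectiveOn n f
    injective t-inj {i} {j} i<n j<n e with region L i | region L j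
    ... | before i<L | before j<L with <-cmp i j
    ...   | tri< i<j _ _ = ⊥-elim (<⇒≢ (before-increasing i<j j<L) e)
    ...   | tri≈ _ i≡j _ = i≡j
    ...   | tri> _ _ j<i = ⊥-elim (<⇒≢ (before-increasing j<i i<L) (sym e))
    injective t-inj i<n j<n e | before i<L | atL      = ⊥-elim (<⇒≢ (before-positive i<L) (sym (trans e f-at)))
    injective t-inj i<n j<n e | before i<L | after q  = ⊥-elim (before≢after q i<L e)
    injective t-inj i<n j<n e | atL        | before j<L = ⊥-elim (<⇒≢ (before-positive j<L) (trans (sym f-at) e))
    injective t-inj i<n j<n e | atL        | atL      = refl
    injective t-inj i<n j<n e | atL        | after q  = ⊥-elim (<⇒≢ (after-positive q) (trans (sym f-at) e))
    injective t-inj i<n j<n e | after q    | before j<L = ⊥-elim (before≢after q j<L (sym e))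
    injective t-inj i<n j<n e | after q    | atL      = ⊥-elim (<⇒≢ (after-positive q) (sym (trans e f-at)))
    injective t-inj i<n j<n e | after q    | after q′ =
      cong (suc L +_) (t-inj (+-cancelˡ-< (suc L) q m i<n) (+-cancelˡ-< (suc L) q′ m j<n)
        (suffixValue-injective s≤1+L (trans (sym (f-after q)) (trans e (f-after q′)))))

    private
      f-after′ : ∀ {p} → suc L ≤ p → f p ≡ suffixValue L s (t (p ∸ suc L))
      f-after′ {p} L<p = trans (cong f (sym (m+[n∸m]≡n L<p))) (f-after (p ∸ suc L))

      after-small′ : ∀ {p} → suc L ≤ p → f p ≤ suc L → f p ≡ s
      after-small′ {p} L<p h = trans (cong f (sym (m+[n∸m]≡n L<p)))
        (after-small (p ∸ suc L) (subst (_≤ suc L) (cong f (sym (m+[n∸m]≡n L<p))) h))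

      after-<-reflects : ∀ {p p′} → suc L ≤ p → suc L ≤ p′ → f p < f p′ → t (p ∸ suc L) < t (p′ ∸ suc L)
      after-<-reflects L<p L<p′ fp<fp′ = suffixValue-<-reflects s≤1+L (subst₂ _<_ (f-after′ L<p) (f-after′ L<p′) fp<fp′)

      after-index : ∀ {p} → suc L ≤ p → p < n → p ∸ suc L < m
      after-index {p} L<p p<n = subst (p ∸ suc L <_) (m+n∸m≡n (suc L) m) (∸-monoˡ-< p<n L<p)

    avoids321 : ¬ Occ321 m t → ¬ Occ321 n f
    avoids321 t-av (occ321 {a} {b} {c} a<b b<c c<n fc<fb fb<fa) with region L a
    ... | after q = t-av (occ321 (∸-monoˡ-< a<b L<a) (∸-monoˡ-< b<c L<b) (after-index L<c c<n)
                            (after-<-reflects L<c L<b fc<fb) (after-<-reflects L<b L<a fb<fa))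
      where
      L<a = m≤m+n (suc L) q
      L<b = ≤-trans L<a (<⇒≤ a<b)
      L<c = ≤-trans L<b (<⇒≤ b<c)
    ... | atL = n≮0 (subst (f b <_) f-at fb<fa)
    ... | before a<L with region L b
    ...   | before b<L = <-asym fb<fa (before-increasing a<b b<L)
    ...   | atL        = n≮0 (subst (f c <_) f-at fc<fb)
    ...   | after q    = <-irrefl (trans fc≡s (sym fb≡s)) fc<fb
      where
      fb≤1+L = <⇒≤ (<-≤-trans fb<fa (before-≤ a<L))
      fb≡s = after-small q fb≤1+L
      fc≡s = after-small′ (≤-trans (m≤m+n (suc L) q) (<⇒≤ b<c)) (<⇒≤ (<-≤-trans fc<fb fb≤1+L))

    avoids4123 : ¬ Occ4123 m t → ¬ Occ4123 n f
    avoids4123 t-av (occ4123 {a} {b} {c} {d} a<b b<c c<d d<n fb<fc fc<fd fd<fa) with region L a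
    ... | after q = t-av (occ4123 (∸-monoˡ-< a<b L<a) (∸-monoˡ-< b<c L<b) (∸-monoˡ-< c<d L<c) (after-index L<d d<n)
                            (after-<-reflects L<b L<c fb<fc) (after-<-reflects L<c L<d fc<fd) (after-<-reflects L<d L<a fd<fa))
      where
      L<a = m≤m+n (suc L) q
      L<b = ≤-trans L<a (<⇒≤ a<b)
      L<c = ≤-trans L<b (<⇒≤ b<c)
      L<d = ≤-trans L<c (<⇒≤ c<d)
    ... | atL = n≮0 (subst (f d <_) f-at fd<fa)
    ... | before a<L = <-irrefl (trans fc≡s (sym fd≡s)) fc<fd
      where
      fd≤1+L = <⇒≤ (<-≤-trans fd<fa (before-≤ a<L))
      L<c : suc L ≤ c
      L<c with region L b
      ... | before b<L = ⊥-elim (<-asym (<-trans fb<fc (<-trans fc<fd fd<fa)) (before-increasing a<b b<L))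
      ... | atL        = b<c
      ... | after q    = ≤-trans (m≤m+n (suc L) q) (<⇒≤ b<c)
      fd≡s = after-small′ (≤-trans L<c (<⇒≤ c<d)) fd≤1+L
      fc≡s = after-small′ L<c (<⇒≤ (<-≤-trans fc<fd fd≤1+L))

    preserves-Avoiding : Avoiding m t → Avoiding n f
    preserves-Avoiding (avoiding t-inj t-av321 t-av4123) = avoiding (injective t-inj) (avoids321 t-av321) (avoids4123 t-av4123)

  prefixValue-separates : ∀ {L s s′} → 1 ≤ s → s < s′ → s′ ≤ suc L → Σ ℕ λ p → p < L × prefixValue s p ≢ prefixValue s′ p
  prefixValue-separates {s = suc p} _ s<s′ s′≤1+L =
    p , ≤-pred (<-≤-trans s<s′ s′≤1+L) ,
    λ e → <-irrefl (trans (sym (prefixValue-below s<s′)) (trans (sym e) (prefixValue-above (<-irrefl refl)))) (n<1+n (suc p))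

  assemble-injective : ∀ L m {s s′} {t t′ : ℕ → ℕ} → 1 ≤ s → s ≤ suc L → 1 ≤ s′ → s′ ≤ suc L →
    (∀ {p} → p < suc L + m → assemble L s t p ≡ assemble L s′ t′ p) → s ≡ s′ × (∀ {q} → q < m → t q ≡ t′ q)
  assemble-injective L m {s} {s′} {t} {t′} 1≤s s≤1+L 1≤s′ s′≤1+L same = s≡s′ , t≗t′
    where
    differ : ∀ {u u′ tu tu′} → 1 ≤ u → u < u′ → u′ ≤ suc L →
      ¬ (∀ {p} → p < suc L + m → assemble L u tu p ≡ assemble L u′ tu′ p)
    differ {u} {u′} {tu} {tu′} 1≤u u<u′ u′≤1+L same′ with prefixValue-separates 1≤u u<u′ u′≤1+L
    ... | p , p<L , ≢ = ≢ (trans (sym (assemble-before L u tu p<L))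
                          (trans (same′ (<-trans p<L (s≤s (m≤m+n L m)))) (assemble-before L u′ tu′ p<L)))
    s≡s′ : s ≡ s′
    s≡s′ with <-cmp s s′
    ... | tri< s<s′ _ _ = ⊥-elim (differ 1≤s s<s′ s′≤1+L same)
    ... | tri≈ _ e _    = e
    ... | tri> _ _ s′<s = ⊥-elim (differ 1≤s′ s′<s s≤1+L (λ p<n → sym (same p<n)))
    t≗t′ : ∀ {q} → q < m → t q ≡ t′ q
    t≗t′ {q} q<m = suffixValue-injective s≤1+L (begin
      suffixValue L s (t q)    ≡⟨ sym (assemble-after L s t q) ⟩
      assemble L s t (suc L + q) ≡⟨ same (+-monoʳ-< (suc L) q<m) ⟩
      assemble L s′ t′ (suc L + q) ≡⟨ assemble-after L s′ t′ q ⟩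
      suffixValue L s′ (t′ q)  ≡⟨ cong (λ u → suffixValue L u (t′ q)) (sym s≡s′) ⟩
      suffixValue L s (t′ q)   ∎)
      where open ≡-Reasoning

  -- Decomposing a permutation around its 1

  last-prefixValue-collides : ∀ {L s} (a : ℕ → ℕ) → 1 ≤ s → s ≤ L → (∀ {p} → p < L → a p ≡ prefixValue s p) →
    ¬ (∀ {p} → suc p ≡ L → a p < suc L)
  last-prefixValue-collides {zero}  a 1≤s s≤0   _  _     = <⇒≱ 1≤s s≤0
  last-prefixValue-collides {suc p} a _   s≤1+p a≡ last< =
    <-irrefl (trans (a≡ ≤-refl) (prefixValue-above (λ 1+p<s → <⇒≱ 1+p<s s≤1+p))) (last< refl)

  prefix-shape : ∀ L (a : ℕ → ℕ) → StrictlyIncreasingOn L a → (∀ {p} → p < L → suc p ≤ a p) →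
    (∀ {p} → suc p ≡ L → a p ≤ suc L) →
    Σ ℕ λ s → 1 ≤ s × s ≤ suc L × (∀ {p} → p < L → a p ≡ prefixValue s p)
  prefix-shape zero    a _   _ _ = 1 , ≤-refl , ≤-refl , λ ()
  prefix-shape (suc L) a inc ≥1+p last≤
    with prefix-shape L a (λ p<p′ p′<L → inc p<p′ (m<n⇒m<1+n p′<L)) (λ p<L → ≥1+p (m<n⇒m<1+n p<L)) last≤′
    where
    last≤′ : ∀ {p} → suc p ≡ L → a p ≤ suc L
    last≤′ {p} refl = ≤-pred (<-≤-trans (inc (n<1+n p) (n<1+n (suc p))) (last≤ refl))
  ... | s , 1≤s , s≤1+L , a≡ with a L ≟ suc (suc L)
  ...   | yes aL≡2+L = s , 1≤s , m≤n⇒m≤1+n s≤1+L , a≡′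
    where
    a≡′ : ∀ {p} → p < suc L → a p ≡ prefixValue s p
    a≡′ p<1+L with m<1+n⇒m<n∨m≡n p<1+L
    ... | inj₁ p<L  = a≡ p<L
    ... | inj₂ refl = trans aL≡2+L (sym (prefixValue-above (λ 1+L<s → <⇒≱ 1+L<s s≤1+L)))
  ...   | no aL≢2+L = suc (suc L) , s≤s z≤n , ≤-refl , a≡′
    where
    aL≡1+L : a L ≡ suc L
    aL≡1+L = ≤-antisym (≤-pred (≤∧≢⇒< (last≤ refl) aL≢2+L)) (≥1+p (n<1+n L))
    s≡1+L : s ≡ suc L
    s≡1+L with s ≤? L
    ... | no s≰L = ≤-antisym s≤1+L (≰⇒> s≰L)
    ... | yes s≤L = ⊥-elim (last-prefixValue-collides a 1≤s s≤L a≡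
                      (λ {p} 1+p≡L → subst (a p <_) aL≡1+L (inc (subst (suc p ≤_) 1+p≡L ≤-refl) (n<1+n L))))
    a≡′ : ∀ {p} → p < suc L → a p ≡ prefixValue (suc (suc L)) p
    a≡′ {p} p<1+L with m<1+n⇒m<n∨m≡n p<1+L
    ... | inj₁ p<L  = trans (a≡ p<L) (trans (prefixValue-below (subst (suc p <_) (sym s≡1+L) (s<s p<L)))
                                           (sym (prefixValue-below (s<s (m<n⇒m<1+n p<L)))))
    ... | inj₂ refl = trans aL≡1+L (sym (prefixValue-below ≤-refl))

  pigeonholeℕ : ∀ {k} (h : ℕ → ℕ) → (∀ {q} → q < suc k → h q < k) →
    Σ ℕ λ i → Σ ℕ λ j → i < j × j < suc k × h i ≡ h j
  pigeonholeℕ {k} h h< with pigeonhole (n<1+n k) (λ x → fromℕ< (h< (toℕ<n x)))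
  ... | i , j , i<j , e = toℕ i , toℕ j , i<j , toℕ<n j ,
    trans (sym (toℕ-fromℕ< _)) (trans (cong toℕ e) (toℕ-fromℕ< _))

  -- The values above M lie in (M, M + m - 2], so at most m - 2 positions carry them.
  two-below : ∀ {m M} (g : ℕ → ℕ) → 2 ≤ m → InjectiveOn m g → (∀ {q} → q < m → suc (g q) < M + m) →
    (∀ {q} → q < m → g q ≢ M) → Σ ℕ λ i → Σ ℕ λ j → i < j × j < m × g i < M × g j < M
  two-below {suc k} {M} g (s≤s 1≤k) inj g< g≢M = two (pigeonholeℕ h h<k)
    where
    h : ℕ → ℕ
    h q with g q <? M
    ... | yes _ = 0
    ... | no _  = g q ∸ M
    h-below : ∀ {q} → g q < M → h q ≡ 0
    h-below {q} gq<M with g q <? M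
    ... | yes _    = refl
    ... | no gq≮M = ⊥-elim (gq≮M gq<M)
    h-above : ∀ {q} → ¬ g q < M → h q ≡ g q ∸ M
    h-above {q} gq≮M with g q <? M
    ... | yes gq<M = ⊥-elim (gq≮M gq<M)
    ... | no _     = refl
    h-above-positive : ∀ {q} → q < suc k → ¬ g q < M → 0 < h q
    h-above-positive q<m gq≮M =
      subst (0 <_) (sym (h-above gq≮M)) (m<n⇒0<n∸m (≤∧≢⇒< (≮⇒≥ gq≮M) (≢-sym (g≢M q<m))))
    h<k : ∀ {q} → q < suc k → h q < k
    h<k {q} q<m with g q <? M
    ... | yes _   = 1≤k
    ... | no gq≮M = subst (g q ∸ M <_) (m+n∸m≡n M k)
                      (∸-monoˡ-< (≤-pred (subst (suc (g q) <_) (+-suc M k) (g< q<m))) (≮⇒≥ gq≮M))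
    two : (Σ ℕ λ i → Σ ℕ λ j → i < j × j < suc k × h i ≡ h j) →
      Σ ℕ λ i → Σ ℕ λ j → i < j × j < suc k × g i < M × g j < M
    two (i , j , i<j , j<m , hi≡hj) = decide (g i <? M) (g j <? M)
      where
      i<m = <-trans i<j j<m
      decide : Dec (g i < M) → Dec (g j < M) → Σ ℕ λ i → Σ ℕ λ j → i < j × j < suc k × g i < M × g j < M
      decide (yes gi<M) (yes gj<M) = i , j , i<j , j<m , gi<M , gj<M
      decide (yes gi<M) (no gj≮M)  = ⊥-elim (<⇒≢ (h-above-positive j<m gj≮M) (trans (sym (h-below gi<M)) hi≡hj))
      decide (no gi≮M)  (yes gj<M) = ⊥-elim (<⇒≢ (h-above-positive i<m gi≮M) (trans (sym (h-below gj<M)) (sym hi≡hj)))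
      decide (no gi≮M)  (no gj≮M)  = ⊥-elim (<⇒≢ i<j (inj i<m j<m
        (∸-cancelʳ-≡ (≮⇒≥ gi≮M) (≮⇒≥ gj≮M) (trans (sym (h-above gi≮M)) (trans hi≡hj (h-above gj≮M))))))

  module Decomposition (L m : ℕ) (f : ℕ → ℕ) (f-avoiding : Avoiding (suc L + m) f)
    (f-maps : MapsInto (suc L + m) f) (f-at : f L ≡ 0) where

    open Avoiding f-avoiding

    private
      n : ℕ
      n = suc L + m

      L<n : L < n
      L<n = s≤s (m≤m+n L m)

      after<n : ∀ {q} → q < m → suc L + q < n
      after<n q<m = +-monoʳ-< (suc L) q<m

      L<after : ∀ q → L < suc L + q
      L<after q = s≤s (m≤m+n L q)

      positive : ∀ {p} → p < n → p ≢ L → 0 < f p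
      positive p<n p≢L = n≢0⇒n>0 (λ fp≡0 → p≢L (injective p<n L<n (trans fp≡0 (sym f-at))))

      prefix-increasing : StrictlyIncreasingOn L f
      prefix-increasing {p} {p′} p<p′ p′<L with <-cmp (f p) (f p′)
      ... | tri< fp<fp′ _ _ = fp<fp′
      ... | tri≈ _ e _ = ⊥-elim (<⇒≢ p<p′ (injective (<-trans (<-trans p<p′ p′<L) L<n) (<-trans p′<L L<n) e))
      ... | tri> _ _ fp′<fp = ⊥-elim (avoids321 (occ321 p<p′ p′<L L<n
              (subst (_< f p′) (sym f-at) (positive (<-trans p′<L L<n) (<⇒≢ p′<L))) fp′<fp))

      prefix-≥ : ∀ {p} → p < L → suc p ≤ f p
      prefix-≥ {zero}  0<L   = positive (<-trans 0<L L<n) (<⇒≢ 0<L)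
      prefix-≥ {suc p} 1+p<L = <-≤-trans (s≤s (prefix-≥ (<-trans (n<1+n p) 1+p<L))) (prefix-increasing (n<1+n p) 1+p<L)

      no-two-below-after : ∀ {p} → p < L → ∀ {i j} → i < j → j < m →
        f (suc L + i) < f p → f (suc L + j) < f p → ⊥
      no-two-below-after {p} p<L {i} {j} i<j j<m fi<fp fj<fp with <-cmp (f (suc L + i)) (f (suc L + j))
      ... | tri< fi<fj _ _ = avoids4123 (occ4123 p<L (L<after i) (+-monoʳ-< (suc L) i<j) (after<n j<m)
              (subst (_< f (suc L + i)) (sym f-at) (positive (after<n (<-trans i<j j<m)) (≢-sym (<⇒≢ (L<after i)))))
              fi<fj fj<fp)
      ... | tri≈ _ e _ = <⇒≢ i<j (+-cancelˡ-≡ (suc L) i j (injective (after<n (<-trans i<j j<m)) (after<n j<m) e))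
      ... | tri> _ _ fj<fi = avoids321 (occ321 (<-trans p<L (L<after i)) (+-monoʳ-< (suc L) i<j) (after<n j<m) fj<fi fi<fp)

      -- If f p exceeded L + 1, two entries after position L would lie below it and complete a 321 or a 4123.
      last-prefix-≤ : ∀ {p} → suc p ≡ L → f p ≤ suc L
      last-prefix-≤ {p} 1+p≡L with f p ≤? suc L
      ... | yes fp≤1+L = fp≤1+L
      ... | no fp≰1+L with two-below (λ q → f (suc L + q)) 2≤m suffix-injective suffix-< suffix≢fp
        where
        p<L : p < L
        p<L = subst (suc p ≤_) 1+p≡L ≤-refl
        L+2≤fp : suc (suc L) ≤ f p
        L+2≤fp = ≰⇒> fp≰1+L
        2≤m : 2 ≤ m
        2≤m = +-cancelˡ-≤ (suc L) 2 m (subst (_≤ suc L + m) (sym (+-comm (suc L) 2))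
                (≤-trans (s≤s L+2≤fp) (f-maps (<-trans p<L L<n))))
        suffix-injective : InjectiveOn m (λ q → f (suc L + q))
        suffix-injective i<m j<m e = +-cancelˡ-≡ (suc L) _ _ (injective (after<n i<m) (after<n j<m) e)
        suffix-< : ∀ {q} → q < m → suc (f (suc L + q)) < f p + m
        suffix-< q<m = ≤-trans (s≤s (f-maps (after<n q<m))) (+-monoˡ-≤ m L+2≤fp)
        suffix≢fp : ∀ {q} → q < m → f (suc L + q) ≢ f p
        suffix≢fp {q} q<m e = <⇒≢ (<-trans p<L (L<after q)) (sym (injective (after<n q<m) (<-trans p<L L<n) e))
      ... | i , j , i<j , j<m , fi<fp , fj<fp = ⊥-elim (no-two-below-after (subst (suc p ≤_) 1+p≡L ≤-refl) i<j j<m fi<fp fj<fp)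

    private
      shape = prefix-shape L f prefix-increasing prefix-≥ last-prefix-≤

    s : ℕ
    s = proj₁ shape

    1≤s : 1 ≤ s
    1≤s = proj₁ (proj₂ shape)

    s≤1+L : s ≤ suc L
    s≤1+L = proj₁ (proj₂ (proj₂ shape))

    private
      prefix≡ : ∀ {p} → p < L → f p ≡ prefixValue s p
      prefix≡ = proj₂ (proj₂ (proj₂ shape))

      suffix-value : ∀ {q} → q < m → f (suc L + q) ≢ s → suc L < f (suc L + q)
      suffix-value {q} q<m fq≢s with f (suc L + q) ≤? suc L
      ... | no fq≰1+L = ≰⇒> fq≰1+L
      ... | yes fq≤1+L with prefixValue-covers (f (suc L + q)) 1≤s s≤1+L
                              (positive (after<n q<m) (≢-sym (<⇒≢ (L<after q)))) fq≤1+L fq≢s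
      ...   | p , p<L , e = ⊥-elim (<⇒≢ (<-trans p<L (L<after q))
                              (injective (<-trans p<L L<n) (after<n q<m) (trans (prefix≡ p<L) e)))

    t : ℕ → ℕ
    t q with f (suc L + q) ≟ s
    ... | yes _ = 0
    ... | no _  = f (suc L + q) ∸ suc L

    private
      suffixValue-t : ∀ {q} → q < m → suffixValue L s (t q) ≡ f (suc L + q)
      suffixValue-t {q} q<m with f (suc L + q) ≟ s
      ... | yes fq≡s = sym fq≡s
      ... | no fq≢s  = trans (suffixValue-suc (m<n⇒0<n∸m (suffix-value q<m fq≢s)))
                             (m+[n∸m]≡n (<⇒≤ (suffix-value q<m fq≢s)))

      t-<-lifts : ∀ {a b} → a < m → b < m → t a < t b → f (suc L + a) < f (suc L + b)
      t-<-lifts a<m b<m ta<tb = subst₂ _<_ (suffixValue-t a<m) (suffixValue-t b<m) (suffixValue-increasing s≤1+L ta<tb)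

    t-maps : MapsInto m t
    t-maps {q} q<m with f (suc L + q) ≟ s
    ... | yes _    = ≤-<-trans z≤n q<m
    ... | no fq≢s  = subst (f (suc L + q) ∸ suc L <_) (m+n∸m≡n (suc L) m)
                       (∸-monoˡ-< (f-maps (after<n q<m)) (<⇒≤ (suffix-value q<m fq≢s)))

    t-avoiding : Avoiding m t
    t-avoiding = avoiding t-injective t-avoids321 t-avoids4123
      where
      t-injective : InjectiveOn m t
      t-injective {i} {j} i<m j<m e = +-cancelˡ-≡ (suc L) i j (injective (after<n i<m) (after<n j<m)
        (trans (sym (suffixValue-t i<m)) (trans (cong (suffixValue L s) e) (suffixValue-t j<m))))
      t-avoids321 : ¬ Occ321 m t
      t-avoids321 (occ321 a<b b<c c<m v₁ v₂) = avoids321 (occ321 (+-monoʳ-< (suc L) a<b) (+-monoʳ-< (suc L) b<c)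
        (after<n c<m) (t-<-lifts c<m b<m v₁) (t-<-lifts b<m a<m v₂))
        where
        b<m = <-trans b<c c<m
        a<m = <-trans a<b b<m
      t-avoids4123 : ¬ Occ4123 m t
      t-avoids4123 (occ4123 a<b b<c c<d d<m w₁ w₂ w₃) = avoids4123 (occ4123 (+-monoʳ-< (suc L) a<b)
        (+-monoʳ-< (suc L) b<c) (+-monoʳ-< (suc L) c<d) (after<n d<m)
        (t-<-lifts b<m c<m w₁) (t-<-lifts c<m d<m w₂) (t-<-lifts d<m a<m w₃))
        where
        c<m = <-trans c<d d<m
        b<m = <-trans b<c c<m
        a<m = <-trans a<b b<m

    f≗assemble : ∀ {p} → p < n → f p ≡ assemble L s t p
    f≗assemble {p} p<n with region L p
    ... | before p<L = trans (prefix≡ p<L) (sym (assemble-before L s t p<L))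
    ... | atL        = trans f-at (sym (assemble-at L s t))
    ... | after q    = trans (sym (suffixValue-t (+-cancelˡ-< (suc L) q m p<n))) (sym (assemble-after L s t q))

    m≡0⇒s≡1+L : m ≡ 0 → s ≡ suc L
    m≡0⇒s≡1+L refl with s ≤? L
    ... | no s≰L  = ≤-antisym s≤1+L (≰⇒> s≰L)
    ... | yes s≤L = ⊥-elim (last-prefixValue-collides f 1≤s s≤L prefix≡
                      (λ {p} 1+p≡L → subst (f p <_) (cong suc (+-identityʳ L)) (f-maps (<-trans (subst (suc p ≤_) 1+p≡L ≤-refl) L<n))))

  S : ∀ n → List (Vec (Fin n) n)
  S n = filter (λ σ → inClass σ Bool.≟ true) (allVecs n n)

  S-at : ∀ n → ℕ → List (Vec (Fin n) n)
  S-at n k = filter (λ σ → (inClass σ ∧ valueAtIsOne σ k) Bool.≟ true) (allVecs n n)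

  S-unique : ∀ n → Unique (S n)
  S-unique n = Unique.filter⁺ _ (allVecs-unique n n)

  ∈-S⁻ : ∀ {n} {σ : Vec (Fin n) n} → σ ∈ S n → Avoiding n (lookupℕ σ)
  ∈-S⁻ {n} {σ} σ∈ = to (inClass⇔Avoiding σ) (proj₂ (∈-filter⁻ _ {xs = allVecs n n} σ∈))

  ∈-S⁺ : ∀ {n} {σ : Vec (Fin n) n} → Avoiding n (lookupℕ σ) → σ ∈ S n
  ∈-S⁺ {n} {σ} av = ∈-filter⁺ _ (∈-allVecs n n σ) (from (inClass⇔Avoiding σ) av)

  ∈-S-at⁻ : ∀ {n L} {σ : Vec (Fin n) n} → σ ∈ S-at n (suc L) → Avoiding n (lookupℕ σ) × L < n × lookupℕ σ L ≡ 0
  ∈-S-at⁻ {n} {L} {σ} σ∈ with to (T-∧ {inClass σ}) (from T-≡ (proj₂ (∈-filter⁻ _ {xs = allVecs n n} σ∈)))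
  ... | inS , one = to (inClass⇔Avoiding σ) (to T-≡ inS) , to (T-valueAtIsOne σ L) (to T-≡ one)

  ∈-S-at⁺ : ∀ {n L} {σ : Vec (Fin n) n} → Avoiding n (lookupℕ σ) → L < n → lookupℕ σ L ≡ 0 → σ ∈ S-at n (suc L)
  ∈-S-at⁺ {n} {L} {σ} av L<n σL≡0 = ∈-filter⁺ _ (∈-allVecs n n σ) (to T-≡ (from T-∧
    (from T-≡ (from (inClass⇔Avoiding σ) av) , from T-≡ (from (T-valueAtIsOne σ L) (L<n , σL≡0)))))

  -- s ranges over 1, …, L+1, except that an empty suffix forces s = L + 1.
  OmittedValue : ℕ → ℕ → Set
  OmittedValue L zero    = ⊤
  OmittedValue L (suc m) = Fin (suc L)

  omitted : ∀ L m → OmittedValue L m → ℕ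
  omitted L zero    _ = suc L
  omitted L (suc m) i = suc (toℕ i)

  omittedValues : ∀ L m → List (OmittedValue L m)
  omittedValues L zero    = tt ∷ []
  omittedValues L (suc m) = allFin (suc L)

  omittedValues-unique : ∀ L m → Unique (omittedValues L m)
  omittedValues-unique L zero    = All.[] ∷ []
  omittedValues-unique L (suc m) = Unique.allFin⁺ (suc L)

  omitted-range : ∀ L m o → 1 ≤ omitted L m o × omitted L m o ≤ suc L
  omitted-range L zero    _ = s≤s z≤n , ≤-refl
  omitted-range L (suc m) i = s≤s z≤n , toℕ<n i

  omitted-fills : ∀ L m o → 1 ≤ m ⊎ omitted L m o ≡ suc L
  omitted-fills L zero    _ = inj₂ refl
  omitted-fills L (suc m) _ = inj₁ (s≤s z≤n)

  omitted-injective : ∀ L m {o o′} → omitted L m o ≡ omitted L m o′ → o ≡ o′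
  omitted-injective L zero    _ = refl
  omitted-injective L (suc m) e = toℕ-injective (suc-injective e)

  omitted-onto : ∀ L m {s} → 1 ≤ s → s ≤ suc L → (m ≡ 0 → s ≡ suc L) →
    Σ (OmittedValue L m) λ o → o ∈ omittedValues L m × omitted L m o ≡ s
  omitted-onto L zero    _   _     s≡1+L = tt , here refl , sym (s≡1+L refl)
  omitted-onto L (suc m) {suc s} _ s<1+L _ = fromℕ< s<1+L , ∈-allFin _ , cong suc (toℕ-fromℕ< s<1+L)

  module AssembleBijection (L m : ℕ) where

    private
      n : ℕ
      n = suc L + m
      Pairs = OmittedValue L m × Vec (Fin m) m

      shape : Pairs → ℕ → ℕ
      shape (o , τ) = assemble L (omitted L m o) (lookupℕ τ)

      module Shape (y : Pairs) = Assembled L m (omitted L m (proj₁ y)) (lookupℕ (proj₂ y))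
        (proj₁ (omitted-range L m (proj₁ y))) (proj₂ (omitted-range L m (proj₁ y)))

    encode : Pairs → Vec (Fin n) n
    encode y@(o , τ) = tabulateℕ n (shape y) (Shape.mapsInto y (lookupℕ-< τ) (omitted-fills L m o))

    private
      encode-lookup : ∀ y {p} → p < n → lookupℕ (encode y) p ≡ shape y p
      encode-lookup y@(o , τ) = lookupℕ-tabulateℕ n (shape y) (Shape.mapsInto y (lookupℕ-< τ) (omitted-fills L m o))

    encode-injective : ∀ {y y′} → encode y ≡ encode y′ → y ≡ y′
    encode-injective {o , τ} {o′ , τ′} e =
      cong₂ _,_ (omitted-injective L m (proj₁ same-shape)) (lookupℕ-injective τ τ′ (proj₂ same-shape))
      where
      same-shape = assemble-injective L m (proj₁ (omitted-range L m o)) (proj₂ (omitted-range L m o))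
        (proj₁ (omitted-range L m o′)) (proj₂ (omitted-range L m o′))
        (λ {p} p<n → trans (sym (encode-lookup (o , τ) p<n)) (trans (cong (λ v → lookupℕ v p) e) (encode-lookup (o′ , τ′) p<n)))

    encode-into : ∀ {y} → y ∈ cartesianProduct (omittedValues L m) (S m) → encode y ∈ S-at n (suc L)
    encode-into {y@(o , τ)} y∈ = ∈-S-at⁺
      (Avoiding-cong (λ p<n → sym (encode-lookup y p<n))
        (Shape.preserves-Avoiding y (∈-S⁻ (proj₂ (∈-cartesianProduct⁻ (omittedValues L m) (S m) y∈)))))
      L<n (trans (encode-lookup y L<n) (assemble-at L _ _))
      where
      L<n : L < n
      L<n = s≤s (m≤m+n L m)

    encode-onto : ∀ {σ} → σ ∈ S-at n (suc L) → Σ Pairs λ y → y ∈ cartesianProduct (omittedValues L m) (S m) × σ ≡ encode y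
    encode-onto {σ} σ∈ = preimage (proj₁ (∈-S-at⁻ σ∈)) (proj₂ (proj₂ (∈-S-at⁻ σ∈)))
      where
      preimage : Avoiding n (lookupℕ σ) → lookupℕ σ L ≡ 0 →
        Σ Pairs λ y → y ∈ cartesianProduct (omittedValues L m) (S m) × σ ≡ encode y
      preimage σ-avoiding σL≡0 = (o , τ) , ∈-cartesianProduct⁺ o∈ (∈-S⁺ τ-avoiding) , lookupℕ-injective σ (encode (o , τ)) σ≗
        where
        module D = Decomposition L m (lookupℕ σ) σ-avoiding (lookupℕ-< σ) σL≡0
        o-spec = omitted-onto L m D.1≤s D.s≤1+L D.m≡0⇒s≡1+L
        o = proj₁ o-spec
        o∈ = proj₁ (proj₂ o-spec)
        omitted≡s = proj₂ (proj₂ o-spec)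
        τ : Vec (Fin m) m
        τ = tabulateℕ m D.t D.t-maps
        τ≗t : ∀ {q} → q < m → D.t q ≡ lookupℕ τ q
        τ≗t q<m = sym (lookupℕ-tabulateℕ m D.t D.t-maps q<m)
        τ-avoiding : Avoiding m (lookupℕ τ)
        τ-avoiding = Avoiding-cong τ≗t D.t-avoiding
        σ≗ : ∀ {p} → p < n → lookupℕ σ p ≡ lookupℕ (encode (o , τ)) p
        σ≗ p<n = trans (D.f≗assemble p<n) (trans (cong (λ s → assemble L s D.t _) (sym omitted≡s))
                   (trans (assemble-cong L m _ τ≗t p<n) (sym (encode-lookup (o , τ) p<n))))

    length-S-at : length (S-at n (suc L)) ≡ length (omittedValues L m) * length (S m)
    length-S-at = trans (length-≡-by-bijection (Unique.filter⁺ _ (allVecs-unique n n))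
                    (Unique.cartesianProduct⁺ (omittedValues-unique L m) (S-unique m))
                    encode encode-injective encode-into encode-onto)
                  (length-cartesianProduct (omittedValues L m) (S m))

  countSk-split : ∀ L m → 1 ≤ m → countSk (suc L + m) (suc L) ≡ suc L * countS m
  countSk-split L (suc m) _ =
    trans (AssembleBijection.length-S-at L (suc m)) (cong (_* countS (suc m)) (length-tabulate {n = suc L} (λ i → i)))

  countSk-last : ∀ L → countSk (suc L) (suc L) ≡ 1
  countSk-last L = subst (λ n → countSk n (suc L) ≡ 1) (+-identityʳ (suc L)) (AssembleBijection.length-S-at L 0)

  countSk≡ : ∀ n k → 1 ≤ k → k < n → countSk n k ≡ k * countS (n ∸ k)
  countSk≡ n (suc L) _ k<n = subst (λ n′ → countSk n′ (suc L) ≡ suc L * countS (n ∸ suc L)) (m+[n∸m]≡n (<⇒≤ k<n))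
    (countSk-split L (n ∸ suc L) (m<n⇒0<n∸m k<n))

  -- Summing over the position of 1

  sumℕ : ℕ → (ℕ → ℕ) → ℕ
  sumℕ zero    f = 0
  sumℕ (suc n) f = f 0 + sumℕ n (λ i → f (suc i))

  sumℕ-cong : ∀ n {f g : ℕ → ℕ} → (∀ {i} → i < n → f i ≡ g i) → sumℕ n f ≡ sumℕ n g
  sumℕ-cong zero    _   = refl
  sumℕ-cong (suc n) f≗g = cong₂ _+_ (f≗g z<s) (sumℕ-cong n (λ i<n → f≗g (s<s i<n)))

  sumℕ-+ : ∀ n (f g : ℕ → ℕ) → sumℕ n (λ i → f i + g i) ≡ sumℕ n f + sumℕ n g
  sumℕ-+ zero    f g = refl
  sumℕ-+ (suc n) f g = trans (cong (f 0 + g 0 +_) (sumℕ-+ n (λ i → f (suc i)) (λ i → g (suc i))))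
                             (+-interchange (f 0) (g 0) _ _)

  sumℕ-last : ∀ n (f : ℕ → ℕ) → sumℕ (suc n) f ≡ sumℕ n f + f n
  sumℕ-last zero    f = +-comm (f 0) 0
  sumℕ-last (suc n) f = trans (cong (f 0 +_) (sumℕ-last n (λ i → f (suc i)))) (sym (+-assoc (f 0) _ _))

  sumℕ-zero : ∀ n (f : ℕ → ℕ) → (∀ {i} → i < n → f i ≡ 0) → sumℕ n f ≡ 0
  sumℕ-zero n f f≡0 = trans (sumℕ-cong n f≡0) (zeros n)
    where
    zeros : ∀ n → sumℕ n (λ _ → 0) ≡ 0
    zeros zero    = refl
    zeros (suc n) = zeros n

  sumℕ-single : ∀ n (f : ℕ → ℕ) {p} → p < n → (∀ {i} → i < n → i ≢ p → f i ≡ 0) → sumℕ n f ≡ f p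
  sumℕ-single (suc n) f {zero}  _         others = trans (cong (f 0 +_) (sumℕ-zero n _ (λ i<n → others (s<s i<n) (λ ())))) (+-identityʳ (f 0))
  sumℕ-single (suc n) f {suc p} (s<s p<n) others =
    trans (cong (_+ sumℕ n (λ i → f (suc i))) (others z<s (λ ())))
          (sumℕ-single n (λ i → f (suc i)) p<n (λ i<n i≢p → others (s<s i<n) (λ e → i≢p (suc-injective e))))

  indicator : Bool → ℕ
  indicator true  = 1
  indicator false = 0

  #_[_] : ∀ {A : Set} → List A → (A → Bool) → ℕ
  # xs [ p ] = length (filter (λ x → p x Bool.≟ true) xs)

  #-∷ : ∀ {A : Set} (p : A → Bool) x xs → # (x ∷ xs) [ p ] ≡ indicator (p x) + # xs [ p ]
  #-∷ p x xs with p x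
  ... | true  = refl
  ... | false = refl

  #-split : ∀ {A : Set} (p : A → Bool) (q : ℕ → A → Bool) k →
    (∀ x → p x ≡ true → Σ ℕ λ i → i < k × q i x ≡ true × (∀ {j} → j < k → q j x ≡ true → j ≡ i)) →
    ∀ xs → # xs [ p ] ≡ sumℕ k (λ i → # xs [ (λ x → p x ∧ q i x) ])
  #-split p q k unique [] = sym (sumℕ-zero k _ (λ _ → refl))
  #-split p q k unique (x ∷ xs) = begin
    # (x ∷ xs) [ p ]                                                  ≡⟨ #-∷ p x xs ⟩
    indicator (p x) + # xs [ p ]                                      ≡⟨ cong₂ _+_ (split-one (p x) refl) (#-split p q k unique xs) ⟩
    sumℕ k (λ i → indicator (p x ∧ q i x)) + sumℕ k (λ i → # xs [ (λ y → p y ∧ q i y) ])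
                                                                      ≡⟨ sym (sumℕ-+ k _ _) ⟩
    sumℕ k (λ i → indicator (p x ∧ q i x) + # xs [ (λ y → p y ∧ q i y) ])
                                                                      ≡⟨ sumℕ-cong k (λ {i} _ → sym (#-∷ (λ y → p y ∧ q i y) x xs)) ⟩
    sumℕ k (λ i → # (x ∷ xs) [ (λ y → p y ∧ q i y) ])                 ∎
    where
    open ≡-Reasoning
    split-one : ∀ b → p x ≡ b → indicator b ≡ sumℕ k (λ i → indicator (b ∧ q i x))
    split-one false _ = sym (sumℕ-zero k _ (λ _ → refl))
    split-one true px with unique x px
    ... | i , i<k , qix , only-i = sym (trans (sumℕ-single k _ i<k others) (cong indicator qix))
      where
      others : ∀ {j} → j < k → j ≢ i → indicator (q j x) ≡ 0
      others {j} j<k j≢i with q j x in qjx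
      ... | true  = ⊥-elim (j≢i (only-i j<k qjx))
      ... | false = refl

  zero-attained : ∀ {n} (f : ℕ → ℕ) → 1 ≤ n → InjectiveOn n f → MapsInto n f → Σ ℕ λ p → p < n × f p ≡ 0
  zero-attained {suc k} f _ inj maps with any? (λ (i : Fin (suc k)) → f (toℕ i) ≟ 0)
  ... | yes (i , fi≡0) = toℕ i , toℕ<n i , fi≡0
  ... | no no-zero = ⊥-elim (collision (pigeonholeℕ (λ q → f q ∸ 1) (λ q<1+k → ∸-monoˡ-< (maps q<1+k) (positive q<1+k))))
    where
    positive : ∀ {q} → q < suc k → 1 ≤ f q
    positive {q} q<1+k = n≢0⇒n>0 (λ fq≡0 → no-zero (fromℕ< q<1+k , trans (cong f (toℕ-fromℕ< q<1+k)) fq≡0))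
    collision : ¬ (Σ ℕ λ i → Σ ℕ λ j → i < j × j < suc k × f i ∸ 1 ≡ f j ∸ 1)
    collision (i , j , i<j , j<1+k , e) = <⇒≢ i<j (inj i<1+k j<1+k (∸-cancelʳ-≡ (positive i<1+k) (positive j<1+k) e))
      where i<1+k = <-trans i<j j<1+k

  countS-by-position-of-one : ∀ J → countS (suc J) ≡ sumℕ (suc J) (λ i → countSk (suc J) (suc i))
  countS-by-position-of-one J =
    #-split inClass (λ i σ → valueAtIsOne σ (suc i)) (suc J) position-of-one (allVecs (suc J) (suc J))
    where
    position-of-one : ∀ σ → inClass σ ≡ true → Σ ℕ λ i → i < suc J × valueAtIsOne σ (suc i) ≡ true ×
      (∀ {j} → j < suc J → valueAtIsOne σ (suc j) ≡ true → j ≡ i)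
    position-of-one σ σ-in = p , p<n , from (T-valueAtIsOne σ p) (p<n , σp≡0) ,
      λ j<n one-at-j → injective j<n p<n (trans (proj₂ (to (T-valueAtIsOne σ _) one-at-j)) (sym σp≡0))
      where
      open Avoiding (to (inClass⇔Avoiding σ) σ-in)
      zero-at = zero-attained (lookupℕ σ) (s≤s z≤n) injective (lookupℕ-< σ)
      p = proj₁ zero-at
      p<n = proj₁ (proj₂ zero-at)
      σp≡0 = proj₂ (proj₂ zero-at)

  module Recurrence (c : ℕ → ℕ) (c-suc : ∀ J → c (suc J) ≡ sumℕ J (λ i → suc i * c (J ∸ i)) + 1) where

    c-1 : c 1 ≡ 1
    c-1 = c-suc 0

    c-2 : c 2 ≡ 2
    c-2 = trans (c-suc 1) (cong (λ x → x + 0 + 1) (trans (+-identityʳ (c 1)) c-1))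

    private
      V W : ℕ → ℕ
      V J = sumℕ J (λ i → c (J ∸ i))
      W J = sumℕ J (λ i → suc i * c (J ∸ i))

      -- Writing suc i = 1 + i; the i = 0 term of Σ i c(J+1-i) vanishes and the rest is W J.
      W-suc : ∀ J → W (suc J) ≡ V (suc J) + W J
      W-suc J = sumℕ-+ (suc J) (λ i → c (suc J ∸ i)) (λ i → i * c (suc J ∸ i))

      triple : ∀ v d → (v + d) + v + (v + d) + d ≡ 3 * (v + d)
      triple = solve-∀

      c-suc′ : ∀ J → c (suc (suc J)) ≡ V (suc J) + c (suc J)
      c-suc′ J = begin
        c (2 + J)               ≡⟨ c-suc (suc J) ⟩
        W (1 + J) + 1           ≡⟨ cong (_+ 1) (W-suc J) ⟩
        V (1 + J) + W J + 1     ≡⟨ +-assoc (V (1 + J)) (W J) 1 ⟩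
        V (1 + J) + (W J + 1)   ≡⟨ cong (V (1 + J) +_) (sym (c-suc J)) ⟩
        V (1 + J) + c (1 + J)   ∎
        where open ≡-Reasoning

    c-rec : ∀ J → c (3 + J) + c (1 + J) ≡ 3 * c (2 + J)
    c-rec J = begin
      c (3 + J) + c (1 + J)                                ≡⟨ cong (_+ c (1 + J)) (c-suc′ (suc J)) ⟩
      c (2 + J) + V (1 + J) + c (2 + J) + c (1 + J)        ≡⟨ cong (λ a → a + V (1 + J) + a + c (1 + J)) (c-suc′ J) ⟩
      (v + d) + v + (v + d) + d                            ≡⟨ triple v d ⟩
      3 * (v + d)                                          ≡⟨ cong (3 *_) (sym (c-suc′ J)) ⟩
      3 * c (2 + J)                                        ∎
      where
      open ≡-Reasoning
      v = V (1 + J)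
      d = c (1 + J)

  countS-suc : ∀ J → countS (suc J) ≡ sumℕ J (λ i → suc i * countS (J ∸ i)) + 1
  countS-suc J = begin
    countS (suc J)                                              ≡⟨ countS-by-position-of-one J ⟩
    sumℕ (suc J) (λ i → countSk (suc J) (suc i))                ≡⟨ sumℕ-last J _ ⟩
    sumℕ J (λ i → countSk (suc J) (suc i)) + countSk (suc J) (suc J)
      ≡⟨ cong₂ _+_ (sumℕ-cong J (λ i<J → countSk≡ (suc J) _ (s≤s z≤n) (s<s i<J))) (countSk-last J) ⟩
    sumℕ J (λ i → suc i * countS (J ∸ i)) + 1                  ∎
    where open ≡-Reasoning

module PowerSeries where

  open import Data.Empty using (⊥-elim)
  open import Data.Integer as ℤ using (ℤ; +_; -[1+_]; _+_; _*_; -_; _-_)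
  import Data.Integer.Properties as ℤ
  open import Data.Integer.Tactic.RingSolver using (solve-∀)
  open import Data.List using (List; []; _∷_; _++_; map)
  open import Data.Nat as ℕ using (ℕ; zero; suc; _∸_; _≤_; _<_; z≤n; s≤s; _≤?_)
  import Data.Nat.Properties as ℕ
  open import Data.Nat.Properties using (m≤n⇒∃[o]m+o≡n)
  open import Data.Product using (_×_; _,_; proj₁; proj₂)
  open import Data.Sum using (inj₁; inj₂)
  open import Function using (_∘′_)
  open import Relation.Binary.PropositionalEquality
  open import Relation.Nullary using (¬_; yes; no)
  open import Algebra.Properties.CommutativeSemigroup ℤ.+-commutativeSemigroup using ()
    renaming (interchange to +-interchange)

  infix 4 _≋_

  _≋_ : Series → Series → Set
  F ≋ G = ∀ n k → F n k ≡ G n k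

  sumTo-cong : ∀ n {f g : ℕ → ℤ} → (∀ {i} → i ≤ n → f i ≡ g i) → sumTo n f ≡ sumTo n g
  sumTo-cong zero    f≗g = f≗g z≤n
  sumTo-cong (suc n) f≗g = cong₂ _+_ (sumTo-cong n (λ i≤n → f≗g (ℕ.m≤n⇒m≤1+n i≤n))) (f≗g ℕ.≤-refl)

  sumTo-zero : ∀ n (f : ℕ → ℤ) → (∀ {i} → i ≤ n → f i ≡ + 0) → sumTo n f ≡ + 0
  sumTo-zero zero    f f≡0 = f≡0 z≤n
  sumTo-zero (suc n) f f≡0 = cong₂ _+_ (sumTo-zero n f (λ i≤n → f≡0 (ℕ.m≤n⇒m≤1+n i≤n))) (f≡0 ℕ.≤-refl)

  sumTo-single : ∀ n (f : ℕ → ℤ) {i₀} → i₀ ≤ n → (∀ {i} → i ≤ n → i ≢ i₀ → f i ≡ + 0) → sumTo n f ≡ f i₀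
  sumTo-single zero    f z≤n _ = refl
  sumTo-single (suc n) f {i₀} i₀≤1+n others with ℕ.m≤n⇒m<n∨m≡n i₀≤1+n
  ... | inj₂ refl = trans (cong (_+ f (suc n)) (sumTo-zero n f (λ i≤n → others (ℕ.m≤n⇒m≤1+n i≤n) (ℕ.<⇒≢ (s≤s i≤n)))))
                          (ℤ.+-identityˡ _)
  ... | inj₁ i₀<1+n = trans (cong₂ _+_ (sumTo-single n f (ℕ.≤-pred i₀<1+n) (λ i≤n → others (ℕ.m≤n⇒m≤1+n i≤n)))
                                        (others ℕ.≤-refl (ℕ.<⇒≢ i₀<1+n ∘′ sym)))
                            (ℤ.+-identityʳ _)

  sumTo-+ : ∀ n (f g : ℕ → ℤ) → sumTo n (λ i → f i + g i) ≡ sumTo n f + sumTo n g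
  sumTo-+ zero    f g = refl
  sumTo-+ (suc n) f g = trans (cong (_+ (f (suc n) + g (suc n))) (sumTo-+ n f g)) (+-interchange (sumTo n f) (sumTo n g) (f (suc n)) (g (suc n)))

  δ : Series
  δ zero zero = + 1
  δ _    _    = + 0

  shift : ℕ → ℕ → Series → Series
  shift a b F n k with a ≤? n | b ≤? k
  ... | yes _ | yes _ = F (n ∸ a) (k ∸ b)
  ... | _     | _     = + 0

  shift-≤ : ∀ a b F {n k} → a ≤ n → b ≤ k → shift a b F n k ≡ F (n ∸ a) (k ∸ b)
  shift-≤ a b F {n} {k} a≤n b≤k with a ≤? n | b ≤? k
  ... | yes _ | yes _   = refl
  ... | no a≰n | _      = ⊥-elim (a≰n a≤n)
  ... | yes _ | no b≰k  = ⊥-elim (b≰k b≤k)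

  shift-≰ : ∀ a b F {n k} → ¬ (a ≤ n × b ≤ k) → shift a b F n k ≡ + 0
  shift-≰ a b F {n} {k} out with a ≤? n | b ≤? k
  ... | yes a≤n | yes b≤k = ⊥-elim (out (a≤n , b≤k))
  ... | no _    | _       = refl
  ... | yes _   | no _    = refl

  data ShiftView (a b : ℕ) (F : Series) (n k : ℕ) : Set where
    inside  : a ≤ n → b ≤ k → shift a b F n k ≡ F (n ∸ a) (k ∸ b) → ShiftView a b F n k
    outside : ¬ (a ≤ n × b ≤ k) → shift a b F n k ≡ + 0 → ShiftView a b F n k

  shiftView : ∀ a b F n k → ShiftView a b F n k
  shiftView a b F n k with a ≤? n | b ≤? k
  ... | yes a≤n | yes b≤k = inside a≤n b≤k (shift-≤ a b F a≤n b≤k)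
  ... | no a≰n  | _       = outside (a≰n ∘′ proj₁) (shift-≰ a b F (a≰n ∘′ proj₁))
  ... | yes _   | no b≰k  = outside (b≰k ∘′ proj₂) (shift-≰ a b F (b≰k ∘′ proj₂))

  shift-cong : ∀ a b {F G} → F ≋ G → shift a b F ≋ shift a b G
  shift-cong a b F≋G n k with a ≤? n | b ≤? k
  ... | yes _ | yes _ = F≋G _ _
  ... | no _  | _     = refl
  ... | yes _ | no _  = refl

  shift-pointwise : ∀ a b (_∙_ : ℤ → ℤ → ℤ) → (+ 0) ∙ (+ 0) ≡ + 0 → ∀ F G →
    shift a b (λ x y → F x y ∙ G x y) ≋ (λ n k → shift a b F n k ∙ shift a b G n k)
  shift-pointwise a b _∙_ 0∙0 F G n k with a ≤? n | b ≤? k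
  ... | yes _ | yes _ = refl
  ... | no _  | _     = sym 0∙0
  ... | yes _ | no _  = sym 0∙0

  shift-0 : ∀ a b → shift a b (λ _ _ → + 0) ≋ (λ _ _ → + 0)
  shift-0 a b n k with a ≤? n | b ≤? k
  ... | yes _ | yes _ = refl
  ... | no _  | _     = refl
  ... | yes _ | no _  = refl

  shift-+ : ∀ a b F G → shift a b (λ x y → F x y + G x y) ≋ (λ n k → shift a b F n k + shift a b G n k)
  shift-+ a b = shift-pointwise a b _+_ refl

  shift-* : ∀ a b F c → shift a b (λ x y → F x y * c) ≋ (λ n k → shift a b F n k * c)
  shift-* a b F c = shift-pointwise a b (λ x _ → x * c) (ℤ.*-zeroˡ c) F F

  m+n≤o⇒n≤o∸m : ∀ {m n o} → m ℕ.+ n ≤ o → n ≤ o ∸ m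
  m+n≤o⇒n≤o∸m {m} {n} {o} m+n≤o = ℕ.m+n≤o⇒m≤o∸n n (subst (_≤ o) (ℕ.+-comm m n) m+n≤o)

  shift-shift : ∀ a b a′ b′ F → shift a b (shift a′ b′ F) ≋ shift (a ℕ.+ a′) (b ℕ.+ b′) F
  shift-shift a b a′ b′ F n k with shiftView (a ℕ.+ a′) (b ℕ.+ b′) F n k
  ... | inside a+a′≤n b+b′≤k e = begin
    shift a b (shift a′ b′ F) n k      ≡⟨ shift-≤ a b _ (ℕ.m+n≤o⇒m≤o a a+a′≤n) (ℕ.m+n≤o⇒m≤o b b+b′≤k) ⟩
    shift a′ b′ F (n ∸ a) (k ∸ b)      ≡⟨ shift-≤ a′ b′ F (m+n≤o⇒n≤o∸m a+a′≤n) (m+n≤o⇒n≤o∸m b+b′≤k) ⟩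
    F (n ∸ a ∸ a′) (k ∸ b ∸ b′)        ≡⟨ cong₂ F (ℕ.∸-+-assoc n a a′) (ℕ.∸-+-assoc k b b′) ⟩
    F (n ∸ (a ℕ.+ a′)) (k ∸ (b ℕ.+ b′)) ≡⟨ sym e ⟩
    shift (a ℕ.+ a′) (b ℕ.+ b′) F n k  ∎
    where open ≡-Reasoning
  ... | outside out e with shiftView a b (shift a′ b′ F) n k
  ...   | outside _ e′ = trans e′ (sym e)
  ...   | inside a≤n b≤k e′ = trans e′ (trans (shift-≰ a′ b′ F (λ (a′≤ , b′≤) → out (within a≤n a′≤ , within b≤k b′≤))) (sym e))
    where
    within : ∀ {u u′ m} → u ≤ m → u′ ≤ m ∸ u → u ℕ.+ u′ ≤ m
    within {u} u≤m u′≤ = subst (u ℕ.+ _ ≤_) (ℕ.m+[n∸m]≡n u≤m) (ℕ.+-monoʳ-≤ u u′≤)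

  shift-δ-at : ∀ a b → shift a b δ a b ≡ + 1
  shift-δ-at a b rewrite shift-≤ a b δ (ℕ.≤-refl {a}) (ℕ.≤-refl {b}) | ℕ.n∸n≡0 a | ℕ.n∸n≡0 b = refl

  shift-δ-off : ∀ a b {x y} → ¬ (x ≡ a × y ≡ b) → shift a b δ x y ≡ + 0
  shift-δ-off a b {x} {y} off with shiftView a b δ x y
  ... | outside _ e = e
  ... | inside a≤x b≤y e = trans e (δ-off (x ∸ a) (y ∸ b) refl refl)
    where
    δ-off : ∀ u v → x ∸ a ≡ u → y ∸ b ≡ v → δ u v ≡ + 0
    δ-off zero    zero    x∸a≡0 y∸b≡0 = ⊥-elim (off (ℕ.≤-antisym (ℕ.m∸n≡0⇒m≤n x∸a≡0) a≤x , ℕ.≤-antisym (ℕ.m∸n≡0⇒m≤n y∸b≡0) b≤y))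
    δ-off zero    (suc v) _ _ = refl
    δ-off (suc u) _       _ _ = refl

  ⊛-congʳ : ∀ F {G G′} → G ≋ G′ → F ⊛ G ≋ F ⊛ G′
  ⊛-congʳ F G≋G′ n k = sumTo-cong n (λ _ → sumTo-cong k (λ _ → cong (F _ _ *_) (G≋G′ _ _)))

  ⊛-⊕ʳ : ∀ F G H → F ⊛ (G ⊕ H) ≋ (F ⊛ G) ⊕ (F ⊛ H)
  ⊛-⊕ʳ F G H n k = trans (sumTo-cong n (λ _ → trans (sumTo-cong k (λ _ → ℤ.*-distribˡ-+ (F _ _) _ _)) (sumTo-+ k _ _)))
                         (sumTo-+ n _ _)

  sumTo-*ʳ : ∀ n (f : ℕ → ℤ) c → sumTo n (λ i → f i * c) ≡ sumTo n f * c
  sumTo-*ʳ zero    f c = refl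
  sumTo-*ʳ (suc n) f c = trans (cong (_+ f (suc n) * c) (sumTo-*ʳ n f c)) (sym (ℤ.*-distribʳ-+ c (sumTo n f) (f (suc n))))

  ⊛-scaleʳ : ∀ F G c → F ⊛ (λ x y → G x y * c) ≋ (λ n k → (F ⊛ G) n k * c)
  ⊛-scaleʳ F G c n k = trans (sumTo-cong n (λ _ → trans (sumTo-cong k (λ _ → sym (ℤ.*-assoc (F _ _) _ c))) (sumTo-*ʳ k _ c)))
                             (sumTo-*ʳ n _ c)

  ⊛-shift-δ : ∀ F a b → F ⊛ shift a b δ ≋ shift a b F
  ⊛-shift-δ F a b n k with shiftView a b F n k
  ... | outside out e = trans (sumTo-zero n _ (λ {i} _ → sumTo-zero k _ (λ {j} _ →
          trans (cong (F _ _ *_) (shift-δ-off a b (λ (n∸i≡a , k∸j≡b) →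
            out (subst (_≤ n) n∸i≡a (ℕ.m∸n≤m n i) , subst (_≤ k) k∸j≡b (ℕ.m∸n≤m k j))))) (ℤ.*-zeroʳ (F _ _)))))
          (sym e)
  ... | inside a≤n b≤k e = begin
    (F ⊛ shift a b δ) n k
      ≡⟨ sumTo-single n _ (ℕ.m∸n≤m n a) (λ i≤n i≢ → sumTo-zero k _ (λ _ →
           trans (cong (F _ _ *_) (shift-δ-off a b (λ (n∸i≡a , _) → i≢ (solve-index a≤n i≤n n∸i≡a)))) (ℤ.*-zeroʳ (F _ _)))) ⟩
    sumTo k (λ j → F (n ∸ a) j * shift a b δ (n ∸ (n ∸ a)) (k ∸ j))
      ≡⟨ sumTo-single k _ (ℕ.m∸n≤m k b) (λ j≤k j≢ →
           trans (cong (F _ _ *_) (shift-δ-off a b (λ (_ , k∸j≡b) → j≢ (solve-index b≤k j≤k k∸j≡b)))) (ℤ.*-zeroʳ (F _ _))) ⟩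
    F (n ∸ a) (k ∸ b) * shift a b δ (n ∸ (n ∸ a)) (k ∸ (k ∸ b))
      ≡⟨ cong (F (n ∸ a) (k ∸ b) *_) (trans (cong₂ (shift a b δ) (ℕ.m∸[m∸n]≡n a≤n) (ℕ.m∸[m∸n]≡n b≤k)) (shift-δ-at a b)) ⟩
    F (n ∸ a) (k ∸ b) * + 1
      ≡⟨ trans (ℤ.*-identityʳ _) (sym e) ⟩
    shift a b F n k ∎
    where
    open ≡-Reasoning
    solve-index : ∀ {u m i} → u ≤ m → i ≤ m → m ∸ i ≡ u → i ≡ m ∸ u
    solve-index {m = m} _ i≤m m∸i≡u = trans (sym (ℕ.m∸[m∸n]≡n i≤m)) (cong (m ∸_) m∸i≡u)

  -- A monomial (a , b , c) stands for c xᵃ tᵇ; multiplying by it shifts and scales (⊛-act).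
  Polynomial : Set
  Polynomial = List (ℕ × ℕ × ℤ)

  monomial : ℕ → ℕ → ℤ → Polynomial
  monomial a b c = (a , b , c) ∷ []

  act : Polynomial → Series → Series
  act []                F n k = + 0
  act ((a , b , c) ∷ P) F n k = shift a b F n k * c + act P F n k

  act-cong : ∀ P {F G} → F ≋ G → act P F ≋ act P G
  act-cong []                F≋G n k = refl
  act-cong ((a , b , c) ∷ P) F≋G n k = cong₂ _+_ (cong (_* c) (shift-cong a b F≋G n k)) (act-cong P F≋G n k)

  ⊛-act : ∀ F P → F ⊛ act P δ ≋ act P F
  ⊛-act F []                n k = sumTo-zero n _ (λ _ → sumTo-zero k _ (λ _ → ℤ.*-zeroʳ (F _ _)))
  ⊛-act F ((a , b , c) ∷ P) n k = trans (⊛-⊕ʳ F (λ x y → shift a b δ x y * c) (act P δ) n k)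
    (cong₂ _+_ (trans (⊛-scaleʳ F (shift a b δ) c n k) (cong (_* c) (⊛-shift-δ F a b n k))) (⊛-act F P n k))

  _·ᴾ_ : Polynomial → Polynomial → Polynomial
  P ·ᴾ []                = []
  P ·ᴾ ((a , b , c) ∷ Q) = map (λ (a′ , b′ , c′) → (a ℕ.+ a′ , b ℕ.+ b′ , c′ * c)) P ++ (P ·ᴾ Q)

  -ᴾ_ : Polynomial → Polynomial
  -ᴾ_ = map (λ (a , b , c) → (a , b , - c))

  act-++ : ∀ P Q F n k → act (P ++ Q) F n k ≡ act P F n k + act Q F n k
  act-++ []                Q F n k = sym (ℤ.+-identityˡ _)
  act-++ ((a , b , c) ∷ P) Q F n k = trans (cong (λ z → shift a b F n k * c + z) (act-++ P Q F n k))
                                           (sym (ℤ.+-assoc (shift a b F n k * c) _ _))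

  act-neg : ∀ P F n k → act (-ᴾ P) F n k ≡ - act P F n k
  act-neg []                F n k = refl
  act-neg ((a , b , c) ∷ P) F n k =
    trans (cong (λ z → shift a b F n k * - c + z) (act-neg P F n k)) (negate (shift a b F n k) c (act P F n k))
    where
    negate : ∀ x c y → x * - c + - y ≡ - (x * c + y)
    negate = solve-∀

  act-shifted : ∀ a b c P F n k →
    act (map (λ (a′ , b′ , c′) → (a ℕ.+ a′ , b ℕ.+ b′ , c′ * c)) P) F n k ≡ shift a b (act P F) n k * c
  act-shifted a b c []                  F n k = sym (cong (_* c) (shift-0 a b n k))
  act-shifted a b c ((a′ , b′ , c′) ∷ P) F n k = begin
    shift (a ℕ.+ a′) (b ℕ.+ b′) F n k * (c′ * c) + act (map _ P) F n k
      ≡⟨ cong₂ (λ x y → x * (c′ * c) + y) (sym (shift-shift a b a′ b′ F n k)) (act-shifted a b c P F n k) ⟩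
    shift a b (shift a′ b′ F) n k * (c′ * c) + shift a b (act P F) n k * c
      ≡⟨ regroup (shift a b (shift a′ b′ F) n k) c′ c (shift a b (act P F) n k) ⟩
    (shift a b (shift a′ b′ F) n k * c′ + shift a b (act P F) n k) * c
      ≡⟨ cong (_* c) (sym (trans (shift-+ a b (λ x y → shift a′ b′ F x y * c′) (act P F) n k)
                                 (cong (_+ shift a b (act P F) n k) (shift-* a b (shift a′ b′ F) c′ n k)))) ⟩
    shift a b (act ((a′ , b′ , c′) ∷ P) F) n k * c ∎
    where
    open ≡-Reasoning
    regroup : ∀ x c′ c y → x * (c′ * c) + y * c ≡ (x * c′ + y) * c
    regroup = solve-∀

  act-· : ∀ P Q F → act (P ·ᴾ Q) F ≋ act Q (act P F)
  act-· P []                F n k = refl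
  act-· P ((a , b , c) ∷ Q) F n k =
    trans (act-++ (map _ P) (P ·ᴾ Q) F n k) (cong₂ _+_ (act-shifted a b c P F n k) (act-· P Q F n k))

  record Represents (A : Series) (P : Polynomial) : Set where
    constructor represents
    field coefficients : A ≋ act P δ

  represents-⊕ : ∀ {A B P Q} → Represents A P → Represents B Q → Represents (A ⊕ B) (P ++ Q)
  represents-⊕ {P = P} {Q} (represents A≋P) (represents B≋Q) =
    represents (λ n k → trans (cong₂ _+_ (A≋P n k) (B≋Q n k)) (sym (act-++ P Q δ n k)))

  represents-⊖ : ∀ {A B P Q} → Represents A P → Represents B Q → Represents (A ⊖ B) (P ++ (-ᴾ Q))
  represents-⊖ {P = P} {Q} (represents A≋P) (represents B≋Q) =
    represents (λ n k → trans (cong₂ _-_ (A≋P n k) (B≋Q n k))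
      (sym (trans (act-++ P (-ᴾ Q) δ n k) (cong (λ z → act P δ n k + z) (act-neg Q δ n k)))))

  represents-⊛ : ∀ {A B P Q} → Represents A P → Represents B Q → Represents (A ⊛ B) (P ·ᴾ Q)
  represents-⊛ {A} {P = P} {Q} (represents A≋P) (represents B≋Q) =
    represents (λ n k → trans (⊛-congʳ A B≋Q n k) (trans (⊛-act A Q n k)
      (trans (act-cong Q A≋P n k) (sym (act-· P Q δ n k)))))

  represents-const : ∀ c → Represents (const c) (monomial 0 0 c)
  represents-const c = represents coefficients
    where
    coefficients : const c ≋ act (monomial 0 0 c) δ
    coefficients zero    zero    = sym (trans (ℤ.+-identityʳ _) (ℤ.*-identityˡ c))
    coefficients zero    (suc k) = sym (trans (ℤ.+-identityʳ _) (ℤ.*-zeroˡ c))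
    coefficients (suc n) zero    = sym (trans (ℤ.+-identityʳ _) (ℤ.*-zeroˡ c))
    coefficients (suc n) (suc k) = sym (trans (ℤ.+-identityʳ _) (ℤ.*-zeroˡ c))

  represents-X : Represents X (monomial 1 0 (+ 1))
  represents-X = represents coefficients
    where
    coefficients : X ≋ act (monomial 1 0 (+ 1)) δ
    coefficients zero          k       = refl
    coefficients (suc zero)    zero    = refl
    coefficients (suc zero)    (suc k) = refl
    coefficients (suc (suc n)) zero    = refl
    coefficients (suc (suc n)) (suc k) = refl

  represents-T : Represents T (monomial 0 1 (+ 1))
  represents-T = represents coefficients
    where
    coefficients : T ≋ act (monomial 0 1 (+ 1)) δ
    coefficients zero    zero          = refl
    coefficients (suc n) zero          = refl
    coefficients zero    (suc zero)    = refl
    coefficients zero    (suc (suc k)) = refl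
    coefficients (suc n) (suc zero)    = refl
    coefficients (suc n) (suc (suc k)) = refl

  -- The generating function

  1-tx : Series
  1-tx = oneS ⊖ (T ⊛ X)

  quadratic : Series
  quadratic = (oneS ⊖ (const (+ 3) ⊛ X)) ⊕ (X ⊛ X)

  denominator : Series
  denominator = (1-tx ⊛ 1-tx) ⊛ quadratic

  numerator : Series
  numerator = (((T ⊛ X) ⊛ 1-tx) ⊛ quadratic) ⊕ ((T ⊛ X) ⊛ (X ⊖ (X ⊛ X)))

  1ᴾ xᴾ txᴾ 1-txᴾ quadraticᴾ numeratorᴾ : Polynomial
  1ᴾ = monomial 0 0 (+ 1)
  xᴾ = monomial 1 0 (+ 1)
  txᴾ = monomial 0 1 (+ 1) ·ᴾ xᴾ
  1-txᴾ = 1ᴾ ++ (-ᴾ txᴾ)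
  quadraticᴾ = (1ᴾ ++ (-ᴾ (monomial 0 0 (+ 3) ·ᴾ xᴾ))) ++ (xᴾ ·ᴾ xᴾ)
  numeratorᴾ = ((txᴾ ·ᴾ 1-txᴾ) ·ᴾ quadraticᴾ) ++ (txᴾ ·ᴾ (xᴾ ++ (-ᴾ (xᴾ ·ᴾ xᴾ))))

  tx-rep : Represents (T ⊛ X) txᴾ
  tx-rep = represents-⊛ represents-T represents-X

  1-tx-rep : Represents 1-tx 1-txᴾ
  1-tx-rep = represents-⊖ (represents-const (+ 1)) tx-rep

  quadratic-rep : Represents quadratic quadraticᴾ
  quadratic-rep = represents-⊕ (represents-⊖ (represents-const (+ 1)) (represents-⊛ (represents-const (+ 3)) represents-X))
                               (represents-⊛ represents-X represents-X)

  denominator-rep : Represents denominator ((1-txᴾ ·ᴾ 1-txᴾ) ·ᴾ quadraticᴾ)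
  denominator-rep = represents-⊛ (represents-⊛ 1-tx-rep 1-tx-rep) quadratic-rep

  numerator-rep : Represents numerator numeratorᴾ
  numerator-rep = represents-⊕ (represents-⊛ (represents-⊛ tx-rep 1-tx-rep) quadratic-rep)
                               (represents-⊛ tx-rep (represents-⊖ represents-X (represents-⊛ represents-X represents-X)))

  act-1-tx² : ∀ G m j → act (1-txᴾ ·ᴾ 1-txᴾ) G m j ≡ G m j - (shift 1 1 G m j + shift 1 1 G m j) + shift 2 2 G m j
  act-1-tx² G m j = normalise (G m j) (shift 1 1 G m j) (shift 2 2 G m j)
    where
    normalise : ∀ x y z → x * + 1 + (y * - + 1 + (y * - + 1 + (z * + 1 + + 0))) ≡ x - (y + y) + z
    normalise = solve-∀

  act-quadratic : ∀ G n k → act quadraticᴾ G n k ≡ G n k - + 3 * shift 1 0 G n k + shift 2 0 G n k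
  act-quadratic G n k = normalise (G n k) (shift 1 0 G n k) (shift 2 0 G n k)
    where
    normalise : ∀ x y z → x * + 1 + (y * - + 3 + (z * + 1 + + 0)) ≡ x - + 3 * y + z
    normalise = solve-∀

  numerator-t¹ numerator-t² : ℕ → ℤ
  numerator-t¹ 1 = + 1
  numerator-t¹ 2 = -[1+ 1 ]
  numerator-t¹ _ = + 0
  numerator-t² 2 = -[1+ 0 ]
  numerator-t² 3 = + 3
  numerator-t² 4 = -[1+ 0 ]
  numerator-t² _ = + 0

  numeratorCoefficients : Series
  numeratorCoefficients n 1 = numerator-t¹ n
  numeratorCoefficients n 2 = numerator-t² n
  numeratorCoefficients n _ = + 0

  numerator-coefficients : act numeratorᴾ δ ≋ numeratorCoefficients
  numerator-coefficients 0 0 = refl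
  numerator-coefficients 0 1 = refl
  numerator-coefficients 0 2 = refl
  numerator-coefficients 0 (suc (suc (suc k))) = refl
  numerator-coefficients 1 0 = refl
  numerator-coefficients 1 1 = refl
  numerator-coefficients 1 2 = refl
  numerator-coefficients 1 (suc (suc (suc k))) = refl
  numerator-coefficients 2 0 = refl
  numerator-coefficients 2 1 = refl
  numerator-coefficients 2 2 = refl
  numerator-coefficients 2 (suc (suc (suc k))) = refl
  numerator-coefficients 3 0 = refl
  numerator-coefficients 3 1 = refl
  numerator-coefficients 3 2 = refl
  numerator-coefficients 3 (suc (suc (suc k))) = refl
  numerator-coefficients 4 0 = refl
  numerator-coefficients 4 1 = refl
  numerator-coefficients 4 2 = refl
  numerator-coefficients 4 (suc (suc (suc k))) = refl
  numerator-coefficients (suc (suc (suc (suc (suc n))))) 0 = refl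
  numerator-coefficients (suc (suc (suc (suc (suc n))))) 1 = refl
  numerator-coefficients (suc (suc (suc (suc (suc n))))) 2 = refl
  numerator-coefficients (suc (suc (suc (suc (suc n))))) (suc (suc (suc k))) = refl

  module GeneratingFunction (c : ℕ → ℕ) (c-0 : c 0 ≡ 1) (c-1 : c 1 ≡ 1) (c-2 : c 2 ≡ 2)
    (c-rec : ∀ J → c (3 ℕ.+ J) ℕ.+ c (1 ℕ.+ J) ≡ 3 ℕ.* c (2 ℕ.+ J)) where

    diagonal : ℕ → ℕ → ℤ
    diagonal zero    r       = + 0
    diagonal (suc K) zero    = + 1
    diagonal (suc K) (suc r) = + (suc K ℕ.* c (suc r))

    Δ²-t¹ Δ²-t² : ℕ → ℤ
    Δ²-t¹ zero    = + 0
    Δ²-t¹ (suc m) = + c m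
    Δ²-t² 2 = -[1+ 0 ]
    Δ²-t² _ = + 0

    -- (1 - tx)² applied to a series with the given diagonals: only its t¹ and t² coefficients survive.
    Δ² : Series
    Δ² m 1 = Δ²-t¹ m
    Δ² m 2 = Δ²-t² m
    Δ² m _ = + 0

    private
      c-rec-ℤ : ∀ J → + c (3 ℕ.+ J) - + 3 * + c (2 ℕ.+ J) + + c (1 ℕ.+ J) ≡ + 0
      c-rec-ℤ J = begin
        + c (3 ℕ.+ J) - + 3 * + c (2 ℕ.+ J) + + c (1 ℕ.+ J)  ≡⟨ regroup (+ c (3 ℕ.+ J)) (+ c (2 ℕ.+ J)) (+ c (1 ℕ.+ J)) ⟩
        (+ c (3 ℕ.+ J) + + c (1 ℕ.+ J)) - + 3 * + c (2 ℕ.+ J) ≡⟨ cong (_- + 3 * + c (2 ℕ.+ J)) (trans (sym (ℤ.pos-+ (c (3 ℕ.+ J)) (c (1 ℕ.+ J))))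
                                                                 (trans (cong +_ (c-rec J)) (ℤ.pos-* 3 (c (2 ℕ.+ J))))) ⟩
        + 3 * + c (2 ℕ.+ J) - + 3 * + c (2 ℕ.+ J)            ≡⟨ ℤ.+-inverseʳ (+ 3 * + c (2 ℕ.+ J)) ⟩
        + 0                                                  ∎
        where
        open ≡-Reasoning
        regroup : ∀ x y z → x - + 3 * y + z ≡ (x + z) - + 3 * y
        regroup = solve-∀

    apply-quadratic : ∀ n k → Δ² n k - + 3 * shift 1 0 Δ² n k + shift 2 0 Δ² n k ≡ numeratorCoefficients n k
    apply-quadratic 0 0 = refl
    apply-quadratic 0 1 = refl
    apply-quadratic 0 2 = refl
    apply-quadratic 0 (suc (suc (suc k))) = refl
    apply-quadratic 1 0 = refl
    apply-quadratic 1 1 rewrite c-0 = refl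
    apply-quadratic 1 2 = refl
    apply-quadratic 1 (suc (suc (suc k))) = refl
    apply-quadratic 2 0 = refl
    apply-quadratic 2 1 rewrite c-0 | c-1 = refl
    apply-quadratic 2 2 = refl
    apply-quadratic 2 (suc (suc (suc k))) = refl
    apply-quadratic 3 0 = refl
    apply-quadratic 3 1 rewrite c-0 | c-1 | c-2 = refl
    apply-quadratic 3 2 = refl
    apply-quadratic 3 (suc (suc (suc k))) = refl
    apply-quadratic (suc (suc (suc (suc n)))) 0 = refl
    apply-quadratic (suc (suc (suc (suc n)))) 1 = c-rec-ℤ n
    apply-quadratic 4 2 = refl
    apply-quadratic (suc (suc (suc (suc (suc n))))) 2 = refl
    apply-quadratic (suc (suc (suc (suc n)))) (suc (suc (suc k))) = refl

    module _ (F : Series) (F-diagonal : ∀ K r → F (K ℕ.+ r) K ≡ diagonal K r)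
             (F-above : ∀ {m k} → m < k → F m k ≡ + 0) where

      private
        combine : ∀ {x y z x′ y′ z′ : ℤ} → x ≡ x′ → y ≡ y′ → z ≡ z′ → x - (y + y) + z ≡ x′ - (y′ + y′) + z′
        combine refl refl refl = refl

        diagonal-second-difference : ∀ J r →
          diagonal (2 ℕ.+ J) r - (diagonal (1 ℕ.+ J) r + diagonal (1 ℕ.+ J) r) + diagonal J r ≡ Δ² (2 ℕ.+ J ℕ.+ r) (2 ℕ.+ J)
        diagonal-second-difference zero    zero    = refl
        diagonal-second-difference (suc J) zero    = refl
        diagonal-second-difference zero    (suc r) = begin
          + (2 ℕ.* c (suc r)) - (+ (1 ℕ.* c (suc r)) + + (1 ℕ.* c (suc r))) + + 0
            ≡⟨ cong₂ (λ a b → a - (b + b) + + 0) (ℤ.pos-* 2 (c (suc r))) (ℤ.pos-* 1 (c (suc r))) ⟩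
          + 2 * x - (+ 1 * x + + 1 * x) + + 0  ≡⟨ vanishes x ⟩
          + 0 ∎
          where
          open ≡-Reasoning
          x = + c (suc r)
          vanishes : ∀ x → + 2 * x - (+ 1 * x + + 1 * x) + + 0 ≡ + 0
          vanishes = solve-∀
        diagonal-second-difference (suc J) (suc r) = begin
          + ((3 ℕ.+ J) ℕ.* c (suc r)) - (+ ((2 ℕ.+ J) ℕ.* c (suc r)) + + ((2 ℕ.+ J) ℕ.* c (suc r))) + + (suc J ℕ.* c (suc r))
            ≡⟨ combine (as-ℤ 2) (as-ℤ 1) (ℤ.pos-* (suc J) (c (suc r))) ⟩
          (+ 2 + j) * x - ((+ 1 + j) * x + (+ 1 + j) * x) + j * x  ≡⟨ vanishes j x ⟩
          + 0 ∎
          where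
          open ≡-Reasoning
          x = + c (suc r)
          j = + suc J
          as-ℤ : ∀ a → + ((a ℕ.+ suc J) ℕ.* c (suc r)) ≡ (+ a + j) * x
          as-ℤ a = trans (ℤ.pos-* (a ℕ.+ suc J) (c (suc r))) (cong (_* x) (ℤ.pos-+ a (suc J)))
          vanishes : ∀ j x → (+ 2 + j) * x - ((+ 1 + j) * x + (+ 1 + j) * x) + j * x ≡ + 0
          vanishes = solve-∀

      second-difference : ∀ m j → F m j - (shift 1 1 F m j + shift 1 1 F m j) + shift 2 2 F m j ≡ Δ² m j
      second-difference zero zero = combine (F-diagonal 0 0) (refl {x = + 0}) (refl {x = + 0})
      second-difference zero (suc j) = trans (combine (F-above (s≤s z≤n)) (refl {x = + 0}) (refl {x = + 0})) (zero-beyond-t² j)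
        where
        zero-beyond-t² : ∀ j → + 0 - (+ 0 + + 0) + + 0 ≡ Δ² 0 (suc j)
        zero-beyond-t² zero          = refl
        zero-beyond-t² (suc zero)    = refl
        zero-beyond-t² (suc (suc j)) = refl
      second-difference (suc m) zero =
        combine (F-diagonal 0 (suc m)) (refl {x = + 0}) (shift-≰ 2 2 F {suc m} {0} (λ (_ , 2≤0) → ℕ.<⇒≱ (s≤s z≤n) 2≤0))
      second-difference (suc zero) (suc zero) = trans (combine (F-diagonal 1 0) (F-diagonal 0 0) (refl {x = + 0})) (cong +_ (sym c-0))
      second-difference (suc (suc m)) (suc zero) =
        trans (combine (F-diagonal 1 (suc m)) (F-diagonal 0 (suc m)) (refl {x = + 0}))
              (trans (ℤ.+-identityʳ _) (trans (ℤ.+-identityʳ _) (cong +_ (ℕ.*-identityˡ (c (suc m))))))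
      second-difference (suc zero) (suc (suc j)) =
        trans (combine (F-above (s≤s (s≤s z≤n))) (F-above (s≤s z≤n)) (refl {x = + 0})) (zero-beyond-t² j)
        where
        zero-beyond-t² : ∀ j → + 0 - (+ 0 + + 0) + + 0 ≡ Δ² 1 (2 ℕ.+ j)
        zero-beyond-t² zero    = refl
        zero-beyond-t² (suc j) = refl
      second-difference (suc (suc M)) (suc (suc J)) with M ℕ.<? J
      ... | yes M<J = trans (combine (F-above (s≤s (s≤s M<J))) (F-above (s≤s M<J)) (F-above M<J)) (above-diagonal M<J)
        where
        above-diagonal : ∀ {J} → M < J → + 0 - (+ 0 + + 0) + + 0 ≡ Δ² (2 ℕ.+ M) (2 ℕ.+ J)
        above-diagonal {suc J} _ = refl
      ... | no M≮J with m≤n⇒∃[o]m+o≡n (ℕ.≮⇒≥ M≮J)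
      ...   | r , refl = trans (combine (F-diagonal (2 ℕ.+ J) r) (F-diagonal (1 ℕ.+ J) r) (F-diagonal J r))
                               (diagonal-second-difference J r)

      generating-function : F ⊛ denominator ≋ numerator
      generating-function n k = begin
        (F ⊛ denominator) n k                                ≡⟨ ⊛-congʳ F (Represents.coefficients denominator-rep) n k ⟩
        (F ⊛ act ((1-txᴾ ·ᴾ 1-txᴾ) ·ᴾ quadraticᴾ) δ) n k      ≡⟨ ⊛-act F ((1-txᴾ ·ᴾ 1-txᴾ) ·ᴾ quadraticᴾ) n k ⟩
        act ((1-txᴾ ·ᴾ 1-txᴾ) ·ᴾ quadraticᴾ) F n k            ≡⟨ act-· (1-txᴾ ·ᴾ 1-txᴾ) quadraticᴾ F n k ⟩
        act quadraticᴾ (act (1-txᴾ ·ᴾ 1-txᴾ) F) n k            ≡⟨ act-cong quadraticᴾ (λ m j → trans (act-1-tx² F m j) (second-difference m j)) n k ⟩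
        act quadraticᴾ Δ² n k                                 ≡⟨ act-quadratic Δ² n k ⟩
        Δ² n k - + 3 * shift 1 0 Δ² n k + shift 2 0 Δ² n k    ≡⟨ apply-quadratic n k ⟩
        numeratorCoefficients n k                             ≡⟨ sym (numerator-coefficients n k) ⟩
        act numeratorᴾ δ n k                                  ≡⟨ sym (Represents.coefficients numerator-rep n k) ⟩
        numerator n k                                         ∎
        where open ≡-Reasoning

open import Data.Bool using (true; false)
open import Data.Bool.Properties using (T-≡)
open import Data.Empty using (⊥-elim)
open import Data.Integer using (+_)
open import Data.Nat using (ℕ; zero; suc; _≤_; _<_; _+_; _*_; _∸_; _≤ᵇ_; z≤n; s≤s)
open import Data.Nat.Properties
open import Data.Product using (_×_; _,_)
open import Function.Bundles using (Equivalence)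
open import Relation.Binary.PropositionalEquality

open Permutations using (countSk≡; countSk-last; countS-suc; module Recurrence)
open PowerSeries using (module GeneratingFunction)
open Equivalence using (to; from)

open Recurrence countS countS-suc using (c-1; c-2; c-rec)
open GeneratingFunction countS refl c-1 c-2 c-rec using (diagonal; generating-function)

≤ᵇ-true : ∀ {m n} → m ≤ n → (m ≤ᵇ n) ≡ true
≤ᵇ-true m≤n = to T-≡ (≤⇒≤ᵇ m≤n)

g-diagonal : ∀ K r → g (K + r) K ≡ diagonal K r
g-diagonal zero    zero    = refl
g-diagonal zero    (suc r) = refl
g-diagonal (suc K) zero    rewrite +-identityʳ K | ≤ᵇ-true (≤-refl {suc K}) = cong +_ (countSk-last K)
g-diagonal (suc K) (suc r) rewrite ≤ᵇ-true (m≤m+n (suc K) (suc r)) =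
  cong +_ (trans (countSk≡ (suc K + suc r) (suc K) (s≤s z≤n) (m<m+n (suc K) (s≤s z≤n)))
                 (cong (λ m → suc K * countS m) (m+n∸m≡n (suc K) (suc r))))

g-above : ∀ {m k} → m < k → g m k ≡ + 0
g-above {zero}  _ = refl
g-above {suc m} {suc k} m<k with suc k ≤ᵇ suc m in e
... | false = refl
... | true  = ⊥-elim (<-irrefl refl (<-≤-trans m<k (≤ᵇ⇒≤ (suc k) (suc m) (from T-≡ e))))

mainTheorem1 : ((n k : ℕ) → 1 ≤ k → k < n → countSk n k ≡ k * countS (n ∸ k))
    × ((n k : ℕ) →
    (g ⊛ (((oneS ⊖ (T ⊛ X)) ⊛ (oneS ⊖ (T ⊛ X))) ⊛ ((oneS ⊖ (const (+ 3) ⊛ X)) ⊕ (X ⊛ X)))) n k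
    ≡ ((((T ⊛ X) ⊛ (oneS ⊖ (T ⊛ X))) ⊛ ((oneS ⊖ (const (+ 3) ⊛ X)) ⊕ (X ⊛ X)))
    ⊕ ((T ⊛ X) ⊛ (X ⊖ (X ⊛ X)))) n k)
mainTheorem1 = countSk≡ , generating-function g g-diagonal g-above
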